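{- A language over $A$ is definable by a $\Sigma_2^+$ formula if and only if it is monotone and definable by a $\Sigma_2$ formula.
   Context: Let $\Sigma$ be a finite set of unary predicates and $A=2^\Sigma$. For words $u,v\in A^*$, $u\le_{A^*}v$ iff $|u|=|v|$ and each letter of $u$ is a subset of the corresponding letter of $v$; $L$ is monotone if $u\in L$ and $u\le_{A^*}v$ imply $v\in L$. First-order formulas use unary atoms $a(x)$, $a\in\Sigma$ (true iff $a$ belongs to the letter at position $x$), and binary predicates $<,\le,=,\ne$ on positions. $\Sigma_2$ is the set of formulas $\exists x_1\dots x_n\forall y_1\dots y_m\,\varphi$ with $\varphi$ quantifier-free; $\Sigma_2^+$ is the set of $\Sigma_2$ formulas containing no negation. -}

module Defs where

open import Data.Nat using (ℕ)
open import Data.Bool using (Bool; true)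
open import Data.Fin using (Fin) renaming (_<_ to _<ᶠ_; _≤_ to _≤ᶠ_)
open import Data.Sum using (_⊎_; inj₁; inj₂; [_,_])
open import Data.Product using (_×_; Σ; ∃; _,_)
open import Data.Unit using (⊤)
open import Data.Empty using (⊥)
open import Data.List using (List; length; lookup)
open import Data.List.Relation.Binary.Pointwise using (Pointwise)
open import Relation.Binary.PropositionalEquality using (_≡_)
open import Relation.Nullary using (¬_)
open import Function.Bundles using (_⇔_)

-- Σ = Fin k (k unary predicates); a letter of A = 2^Σ is a subset of Σ,
-- represented by its characteristic function.
Letter : ℕ → Set
Letter k = Fin k → Bool

Word : ℕ → Set
Word k = List (Letter k)

Language : ℕ → Set₁
Language k = Word k → Set

_⊆ᴬ_ : ∀ {k} → Letter k → Letter k → Set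
u ⊆ᴬ v = ∀ a → u a ≡ true → v a ≡ true

_≤ᵂ_ : ∀ {k} → Word k → Word k → Set
u ≤ᵂ v = Pointwise _⊆ᴬ_ u v

Monotone : ∀ {k} → Language k → Set
Monotone L = ∀ u v → L u → u ≤ᵂ v → L v

data QF (k : ℕ) (V : Set) : Set where
  atom  : Fin k → V → QF k V
  lt    : V → V → QF k V
  le    : V → V → QF k V
  eq    : V → V → QF k V
  neq   : V → V → QF k V
  neg   : QF k V → QF k V
  and   : QF k V → QF k V → QF k V
  or    : QF k V → QF k V → QF k V

NegFree : ∀ {k V} → QF k V → Set
NegFree (atom _ _) = ⊤
NegFree (lt _ _)   = ⊤
NegFree (le _ _)   = ⊤
NegFree (eq _ _)   = ⊤
NegFree (neq _ _)  = ⊤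
NegFree (neg _)    = ⊥
NegFree (and φ ψ)  = NegFree φ × NegFree ψ
NegFree (or φ ψ)   = NegFree φ × NegFree ψ

Pos : ∀ {k} → Word k → Set
Pos w = Fin (length w)

evalQF : ∀ {k V} (w : Word k) → (V → Pos w) → QF k V → Set
evalQF w ρ (atom a x) = lookup w (ρ x) a ≡ true
evalQF w ρ (lt x y)   = ρ x <ᶠ ρ y
evalQF w ρ (le x y)   = ρ x ≤ᶠ ρ y
evalQF w ρ (eq x y)   = ρ x ≡ ρ y
evalQF w ρ (neq x y)  = ¬ (ρ x ≡ ρ y)
evalQF w ρ (neg φ)    = ¬ evalQF w ρ φ
evalQF w ρ (and φ ψ)  = evalQF w ρ φ × evalQF w ρ ψ
evalQF w ρ (or φ ψ)   = evalQF w ρ φ ⊎ evalQF w ρ ψ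

-- Σ2 sentence ∃x₁…xₙ ∀y₁…yₘ φ : variables are Fin n (the x's) ⊎ Fin m (the y's)
record Σ₂ (k : ℕ) : Set where
  constructor ∃∀
  field
    n m  : ℕ
    body : QF k (Fin n ⊎ Fin m)

open Σ₂ public

_⊨_ : ∀ {k} → Word k → Σ₂ k → Set
w ⊨ ∃∀ n m φ = Σ (Fin n → Pos w) λ ξ → (η : Fin m → Pos w) → evalQF w [ ξ , η ] φ

Σ₂⁺ : ∀ {k} → Σ₂ k → Set
Σ₂⁺ φ = NegFree (body φ)

Defines : ∀ {k} → Σ₂ k → Language k → Set
Defines φ L = ∀ w → L w ⇔ (w ⊨ φ)

Σ₂-definable : ∀ {k} → Language k → Set
Σ₂-definable L = ∃ λ φ → Defines φ L

Σ₂⁺-definable : ∀ {k} → Language k → Set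
Σ₂⁺-definable L = ∃ λ φ → Σ₂⁺ φ × Defines φ L

-- A negation-free quantifier-free formula stays true when letters grow and the order of the
-- positions is kept, so Σ₂⁺ languages are monotone. Conversely let ∃x̄ ∀ȳ ψ define a monotone
-- language L. Without existential variables, ∀ȳ ψ is equivalent to ∀ȳ ⋁ τ, where τ ranges over
-- the types of ȳ (order and letters) all of whose upward relabellings satisfy ψ, each written
-- positively as "ȳ is ordered as τ and carries at least the letters of τ". With existential
-- variables, a witness x̄ in a word of L is completed by boundedly many marks such that every
-- block between consecutive marks is rich: it splits into m segments each containing every
-- letter of the block. A certificate records the order and letters of the marks and the
-- letters of each block; it is good if ψ holds in the abstract model offering m ordered copies
-- of each letter of each block. A word matching a good certificate upward is in L, as lowering
-- its letters to the certified ones yields a model of ∃x̄ ∀ȳ ψ; and by richness the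
-- certificate of a word of L is good.

module Submission where

open import Defs
open import Level using (0ℓ)
open import Function using (_∘_; id)
open import Function.Bundles using (_⇔_; mk⇔; Equivalence)
open import Data.Empty using (⊥; ⊥-elim)
open import Data.Unit using (⊤; tt)
open import Data.Bool using (Bool; true; false; if_then_else_; _∧_; not)
import Data.Bool.Properties as BP
open import Data.Nat using (ℕ; zero; suc; _+_; _*_; z≤n; s≤s; _<_; _≤_)
import Data.Nat.Properties as ℕP
open import Data.Nat.Solver using (module +-*-Solver)
open import Data.Fin as F using (Fin; zero; suc; toℕ; cast; fromℕ<) renaming (_<_ to _<ᶠ_; _≤_ to _≤ᶠ_)
import Data.Fin.Properties as FP
open import Data.Sum as Sum using (_⊎_; inj₁; inj₂; [_,_]; [_,_]′)
open import Data.Sum.Function.Propositional using (_⊎-⇔_)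
open import Data.Product as Product using (_×_; Σ; ∃; _,_; proj₁; proj₂)
import Data.Product.Properties as ×P
open import Data.Product.Function.NonDependent.Propositional using (_×-⇔_)
open import Data.Product.Relation.Binary.Pointwise.NonDependent using (Pointwise)
open import Data.Product.Relation.Binary.Lex.Strict
  using (×-Lex; ×-compare; ×-irreflexive; ×-asymmetric; ×-transitive; ×-decidable)
open import Data.List using (List; []; _∷_; length; lookup; tabulate; _++_)
import Data.List.Properties as LP
open import Data.List.Membership.Propositional using (_∈_)
import Data.List.Membership.Propositional.Properties as ∈
open import Data.List.Relation.Unary.Any as Any using (here)
import Data.List.Relation.Unary.Any.Properties as AnyP
import Data.List.Relation.Binary.Pointwise as PW
open import Data.Vec as Vec using (Vec; []; _∷_)
import Data.Vec.Properties as VP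
import Data.Vec.Functional as VecF
open import Relation.Binary.Core using (Rel)
open import Relation.Binary.Definitions
  using (Trichotomous; Irreflexive; Asymmetric; Transitive; Decidable; DecidableEquality; tri<; tri≈; tri>)
open import Relation.Binary.PropositionalEquality
  using (_≡_; _≢_; refl; sym; trans; cong; cong₂; subst; subst₂; isEquivalence)
open import Relation.Nullary using (¬_; Dec; yes; no; does)
open import Relation.Nullary.Decidable as Dec using (_×-dec_; _⊎-dec_; ¬?; _→-dec_; dec-true)

record Structure (k : ℕ) (V : Set) : Set₁ where
  field
    Less LessEq Same : V → V → Set
    label            : V → Letter k
open Structure public

infix 4 _⊩_ _⊑_

_⊩_ : ∀ {k V} → Structure k V → QF k V → Set
T ⊩ atom a x = label T x a ≡ true
T ⊩ lt x y   = Less T x y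
T ⊩ le x y   = LessEq T x y
T ⊩ eq x y   = Same T x y
T ⊩ neq x y  = ¬ Same T x y
T ⊩ neg φ    = ¬ T ⊩ φ
T ⊩ and φ ψ  = T ⊩ φ × T ⊩ ψ
T ⊩ or φ ψ   = T ⊩ φ ⊎ T ⊩ ψ

record _⊑_ {k V} (T T′ : Structure k V) : Set where
  field
    Less⇒   : ∀ {x y} → Less T x y → Less T′ x y
    LessEq⇒ : ∀ {x y} → LessEq T x y → LessEq T′ x y
    Same⇒   : ∀ {x y} → Same T x y → Same T′ x y
    Same⇐   : ∀ {x y} → Same T′ x y → Same T x y
    label⊆  : ∀ x → label T x ⊆ᴬ label T′ x
open _⊑_ public

⊩-mono : ∀ {k V} {T T′ : Structure k V} → T ⊑ T′ → ∀ φ → NegFree φ → T ⊩ φ → T′ ⊩ φ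
⊩-mono I (atom a x) _ h              = label⊆ I x a h
⊩-mono I (lt x y) _ h                = Less⇒ I h
⊩-mono I (le x y) _ h                = LessEq⇒ I h
⊩-mono I (eq x y) _ h                = Same⇒ I h
⊩-mono I (neq x y) _ h               = h ∘ Same⇐ I
⊩-mono I (and φ ψ) (nφ , nψ) (h , h′) = ⊩-mono I φ nφ h , ⊩-mono I ψ nψ h′
⊩-mono I (or φ ψ) (nφ , _) (inj₁ h)  = inj₁ (⊩-mono I φ nφ h)
⊩-mono I (or φ ψ) (_ , nψ) (inj₂ h)  = inj₂ (⊩-mono I ψ nψ h)

⊩-transfer : ∀ {k V} {T T′ : Structure k V} → T ⊑ T′ → T′ ⊑ T → ∀ φ → T ⊩ φ → T′ ⊩ φ
⊩-transfer I J (atom a x) h        = label⊆ I x a h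
⊩-transfer I J (lt x y) h          = Less⇒ I h
⊩-transfer I J (le x y) h          = LessEq⇒ I h
⊩-transfer I J (eq x y) h          = Same⇒ I h
⊩-transfer I J (neq x y) h         = h ∘ Same⇐ I
⊩-transfer I J (neg φ) h           = h ∘ ⊩-transfer J I φ
⊩-transfer I J (and φ ψ) (h , h′)  = ⊩-transfer I J φ h , ⊩-transfer I J ψ h′
⊩-transfer I J (or φ ψ) (inj₁ h)   = inj₁ (⊩-transfer I J φ h)
⊩-transfer I J (or φ ψ) (inj₂ h)   = inj₂ (⊩-transfer I J ψ h)

induced : ∀ {k V A} → Rel A 0ℓ → (V → A) → (V → Letter k) → Structure k V
induced _<_ κ ℓ = record
  { Less   = λ x y → κ x < κ y
  ; LessEq = λ x y → κ x < κ y ⊎ κ x ≡ κ y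
  ; Same   = λ x y → κ x ≡ κ y
  ; label  = ℓ
  }

induced-dec : ∀ {k V A} {_<_ : Rel A 0ℓ} → Decidable _<_ → DecidableEquality A →
  (κ : V → A) (ℓ : V → Letter k) → ∀ φ → Dec (induced _<_ κ ℓ ⊩ φ)
induced-dec _<?_ _≟_ κ ℓ (atom a x) = ℓ x a BP.≟ true
induced-dec _<?_ _≟_ κ ℓ (lt x y)   = κ x <? κ y
induced-dec _<?_ _≟_ κ ℓ (le x y)   = (κ x <? κ y) ⊎-dec (κ x ≟ κ y)
induced-dec _<?_ _≟_ κ ℓ (eq x y)   = κ x ≟ κ y
induced-dec _<?_ _≟_ κ ℓ (neq x y)  = ¬? (κ x ≟ κ y)
induced-dec _<?_ _≟_ κ ℓ (neg φ)    = ¬? (induced-dec _<?_ _≟_ κ ℓ φ)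
induced-dec _<?_ _≟_ κ ℓ (and φ ψ)  = induced-dec _<?_ _≟_ κ ℓ φ ×-dec induced-dec _<?_ _≟_ κ ℓ ψ
induced-dec _<?_ _≟_ κ ℓ (or φ ψ)   = induced-dec _<?_ _≟_ κ ℓ φ ⊎-dec induced-dec _<?_ _≟_ κ ℓ ψ

-- Between two induced structures it suffices to preserve the order and
-- equality in one direction: trichotomy of the source order reflects them.
module Embedding {A B : Set} {_<ᴬ_ : Rel A 0ℓ} {_<ᴮ_ : Rel B 0ℓ}
    (compareᴬ : Trichotomous _≡_ _<ᴬ_) (irreflᴮ : Irreflexive _≡_ _<ᴮ_) (asymᴮ : Asymmetric _<ᴮ_)
    {V : Set} {ρ : V → A} {κ : V → B}
    (<-pres : ∀ {x y} → ρ x <ᴬ ρ y → κ x <ᴮ κ y) (≡-pres : ∀ {x y} → ρ x ≡ ρ y → κ x ≡ κ y) where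

  <-refl : ∀ {x y} → κ x <ᴮ κ y → ρ x <ᴬ ρ y
  <-refl {x} {y} h with compareᴬ (ρ x) (ρ y)
  ... | tri< l _ _ = l
  ... | tri≈ _ e _ = ⊥-elim (irreflᴮ (≡-pres e) h)
  ... | tri> _ _ g = ⊥-elim (asymᴮ h (<-pres g))

  ≡-refl : ∀ {x y} → κ x ≡ κ y → ρ x ≡ ρ y
  ≡-refl {x} {y} e with compareᴬ (ρ x) (ρ y)
  ... | tri< l _ _ = ⊥-elim (irreflᴮ e (<-pres l))
  ... | tri≈ _ e′ _ = e′
  ... | tri> _ _ g = ⊥-elim (irreflᴮ (sym e) (<-pres g))

  induced-⊑ : ∀ {k} {ℓ ℓ′ : V → Letter k} → (∀ x → ℓ x ⊆ᴬ ℓ′ x) → induced _<ᴬ_ ρ ℓ ⊑ induced _<ᴮ_ κ ℓ′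
  induced-⊑ ℓ⊆ℓ′ = record
    { Less⇒ = <-pres ; LessEq⇒ = [ inj₁ ∘ <-pres , inj₂ ∘ ≡-pres ] ; Same⇒ = ≡-pres ; Same⇐ = ≡-refl
    ; label⊆ = ℓ⊆ℓ′ }

  induced-⊒ : ∀ {k} {ℓ ℓ′ : V → Letter k} → (∀ x → ℓ′ x ⊆ᴬ ℓ x) → induced _<ᴮ_ κ ℓ′ ⊑ induced _<ᴬ_ ρ ℓ
  induced-⊒ ℓ′⊆ℓ = record
    { Less⇒ = <-refl ; LessEq⇒ = [ inj₁ ∘ <-refl , inj₂ ∘ ≡-refl ] ; Same⇒ = ≡-refl ; Same⇐ = ≡-pres
    ; label⊆ = ℓ′⊆ℓ }

  induced-⇔ : ∀ {k} {ℓ ℓ′ : V → Letter k} → (∀ x a → ℓ x a ≡ ℓ′ x a) →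
    ∀ φ → induced _<ᴬ_ ρ ℓ ⊩ φ ⇔ induced _<ᴮ_ κ ℓ′ ⊩ φ
  induced-⇔ ℓ≗ℓ′ φ = mk⇔ (⊩-transfer I J φ) (⊩-transfer J I φ)
    where
      I = induced-⊑ (λ x a → trans (sym (ℓ≗ℓ′ x a)))
      J = induced-⊒ (λ x a → trans (ℓ≗ℓ′ x a))

positions : ∀ {k V} (w : Word k) → (V → Pos w) → Structure k V
positions w ρ = induced _<ᶠ_ ρ (lookup w ∘ ρ)

evalQF⇔positions : ∀ {k V} (w : Word k) (ρ : V → Pos w) φ → evalQF w ρ φ ⇔ positions w ρ ⊩ φ
evalQF⇔positions w ρ (atom a x) = mk⇔ id id
evalQF⇔positions w ρ (lt x y)   = mk⇔ id id
evalQF⇔positions w ρ (le x y)   = mk⇔ ≤⇒<⊎≡ [ ℕP.<⇒≤ , ℕP.≤-reflexive ∘ cong toℕ ]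
  where
    ≤⇒<⊎≡ : ρ x ≤ᶠ ρ y → ρ x <ᶠ ρ y ⊎ ρ x ≡ ρ y
    ≤⇒<⊎≡ h = [ inj₁ , inj₂ ∘ FP.toℕ-injective ] (ℕP.m≤n⇒m<n∨m≡n h)
evalQF⇔positions w ρ (eq x y)   = mk⇔ id id
evalQF⇔positions w ρ (neq x y)  = mk⇔ id id
evalQF⇔positions w ρ (neg φ)    =
  mk⇔ (λ h → h ∘ Equivalence.from (evalQF⇔positions w ρ φ)) (λ h → h ∘ Equivalence.to (evalQF⇔positions w ρ φ))
evalQF⇔positions w ρ (and φ ψ)  = evalQF⇔positions w ρ φ ×-⇔ evalQF⇔positions w ρ ψ
evalQF⇔positions w ρ (or φ ψ)   = evalQF⇔positions w ρ φ ⊎-⇔ evalQF⇔positions w ρ ψ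

-- Only the numerical values of positions matter, also across different words.
module SameIndices {V : Set} {N N′ : ℕ} {ρ : V → Fin N} {ρ′ : V → Fin N′}
    (same : ∀ x → toℕ (ρ x) ≡ toℕ (ρ′ x)) =
  Embedding FP.<-cmp FP.<-irrefl FP.<-asym {ρ = ρ} {κ = ρ′}
    (λ {x} {y} → subst₂ _<_ (same x) (same y))
    (λ {x} {y} e → FP.toℕ-injective (trans (sym (same x)) (trans (cong toℕ e) (same y))))

Σ₂⁺⇒monotone : ∀ {k} (φ : Σ₂ k) → Σ₂⁺ φ → ∀ u v → u ⊨ φ → u ≤ᵂ v → v ⊨ φ
Σ₂⁺⇒monotone (∃∀ n m ψ) ψ⁺ u v (ξ , u⊨ψ) u≤v = cast e ∘ ξ , v⊨ψ
  where
    e = PW.Pointwise-length u≤v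
    v⊨ψ : ∀ η → evalQF v [ cast e ∘ ξ , η ] ψ
    v⊨ψ η = Equivalence.from (evalQF⇔positions v _ ψ)
      (⊩-mono (SameIndices.induced-⊑ same (λ x → ⊆-at _ _ (same x))) ψ ψ⁺
        (Equivalence.to (evalQF⇔positions u _ ψ) (u⊨ψ (cast (sym e) ∘ η))))
      where
        same : ∀ x → toℕ ([ ξ , cast (sym e) ∘ η ] x) ≡ toℕ ([ cast e ∘ ξ , η ] x)
        same (inj₁ i) = sym (FP.toℕ-cast e (ξ i))
        same (inj₂ j) = FP.toℕ-cast (sym e) (η j)
        ⊆-at : ∀ p q → toℕ p ≡ toℕ q → lookup u p ⊆ᴬ lookup v q
        ⊆-at p q p≡q = subst (λ r → lookup u p ⊆ᴬ lookup v r)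
          (FP.toℕ-injective (trans (FP.toℕ-cast e p) p≡q)) (PW.lookup⁺ u≤v p)

relabel : ∀ {k} (w : Word k) → (Pos w → Letter k) → Word k
relabel w f = tabulate f

module _ {k} (w : Word k) (f : Pos w → Letter k) where

  length-relabel : length (relabel w f) ≡ length w
  length-relabel = LP.length-tabulate f

  lookup-relabel : ∀ q p → toℕ q ≡ toℕ p → lookup (relabel w f) q ≡ f p
  lookup-relabel q p q≡p = trans
    (cong (lookup (relabel w f)) (FP.toℕ-injective (trans q≡p (sym (FP.toℕ-cast _ p)))))
    (LP.lookup-tabulate f p)

  relabel-⇔ : ∀ {V} (ρ : V → Pos w) (ρ′ : V → Pos (relabel w f)) → (∀ x → toℕ (ρ′ x) ≡ toℕ (ρ x)) →
    ∀ φ → positions (relabel w f) ρ′ ⊩ φ ⇔ induced _<ᶠ_ ρ (f ∘ ρ) ⊩ φ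
  relabel-⇔ ρ ρ′ same = SameIndices.induced-⇔ same (λ x a → cong (λ ℓ → ℓ a) (lookup-relabel (ρ′ x) (ρ x) (same x)))

  ≤ᵂ-relabel : (∀ p → lookup w p ⊆ᴬ f p) → w ≤ᵂ relabel w f
  ≤ᵂ-relabel grows = PW.lookup⁻ (sym length-relabel) λ {p} {q} p≡q →
    subst (lookup w p ⊆ᴬ_) (sym (lookup-relabel q p (sym p≡q))) (grows p)

  relabel-≤ᵂ : (∀ p → f p ⊆ᴬ lookup w p) → relabel w f ≤ᵂ w
  relabel-≤ᵂ shrinks = PW.lookup⁻ length-relabel λ {q} {p} q≡p →
    subst (_⊆ᴬ lookup w p) (sym (lookup-relabel q p q≡p)) (shrinks p)

record Enumeration (X : Set) : Set where
  field
    size       : ℕ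
    enum       : Fin size → X
    index      : X → Fin size
    enum-index : ∀ x → enum (index x) ≡ x
open Enumeration public

Fin-enumeration : ∀ n → Enumeration (Fin n)
Fin-enumeration n = record { size = n ; enum = id ; index = id ; enum-index = λ _ → refl }

retract-enumeration : ∀ {X Y : Set} → Enumeration X → (f : X → Y) (g : Y → X) → (∀ y → f (g y) ≡ y) →
  Enumeration Y
retract-enumeration E f g f∘g = record
  { size = size E ; enum = f ∘ enum E ; index = index E ∘ g
  ; enum-index = λ y → trans (cong f (enum-index E (g y))) (f∘g y) }

⊎-enumeration : ∀ {X Y : Set} → Enumeration X → Enumeration Y → Enumeration (X ⊎ Y)
⊎-enumeration E E′ = record
  { size = size E + size E′
  ; enum = [ inj₁ ∘ enum E , inj₂ ∘ enum E′ ] ∘ F.splitAt (size E)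
  ; index = [ (λ x → index E x F.↑ˡ size E′) , (λ y → size E F.↑ʳ index E′ y) ]
  ; enum-index = λ
      { (inj₁ x) → trans (cong [ inj₁ ∘ enum E , inj₂ ∘ enum E′ ] (FP.splitAt-↑ˡ (size E) (index E x) (size E′)))
                         (cong inj₁ (enum-index E x))
      ; (inj₂ y) → trans (cong [ inj₁ ∘ enum E , inj₂ ∘ enum E′ ] (FP.splitAt-↑ʳ (size E) (size E′) (index E′ y)))
                         (cong inj₂ (enum-index E′ y)) } }

×-enumeration : ∀ {X Y : Set} → Enumeration X → Enumeration Y → Enumeration (X × Y)
×-enumeration E E′ = record
  { size = size E * size E′
  ; enum = λ i → let (i₁ , i₂) = F.remQuot (size E′) i in enum E i₁ , enum E′ i₂
  ; index = λ (x , y) → F.combine (index E x) (index E′ y)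
  ; enum-index = λ (x , y) → let e = FP.remQuot-combine (index E x) (index E′ y) in
      cong₂ _,_ (trans (cong (enum E ∘ proj₁) e) (enum-index E x)) (trans (cong (enum E′ ∘ proj₂) e) (enum-index E′ y)) }

Bool-enumeration : Enumeration Bool
Bool-enumeration = retract-enumeration (Fin-enumeration 2)
  (λ { zero → false ; (suc _) → true }) (λ { false → zero ; true → suc zero }) (λ { false → refl ; true → refl })

Vec-enumeration : ∀ {X : Set} → Enumeration X → ∀ n → Enumeration (Vec X n)
Vec-enumeration E zero    = record { size = 1 ; enum = λ _ → [] ; index = λ _ → zero ; enum-index = λ { [] → refl } }
Vec-enumeration E (suc n) = retract-enumeration (×-enumeration E (Vec-enumeration E n))
  (λ (x , xs) → x ∷ xs) (λ { (x ∷ xs) → x , xs }) (λ { (x ∷ xs) → refl })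

-- P must respect pointwise equality: functions are enumerated only up to it.
∀-dec : ∀ {X : Set} (E : Enumeration X) m {P : (Fin m → X) → Set} → (∀ f → Dec (P f)) →
  (∀ {f g} → (∀ i → f i ≡ g i) → P f → P g) → Dec (∀ f → P f)
∀-dec E zero P? resp with P? (λ ())
... | yes p = yes (λ f → resp (λ ()) p)
... | no ¬p = no (λ ∀P → ¬p (∀P (λ ())))
∀-dec E (suc m) P? resp with FP.all? (λ i → ∀-dec E m (P? ∘ (enum E i VecF.∷_)) (resp ∘ ∷-cong))
  where
    ∷-cong : ∀ {n x} {f g : Fin n → _} → (∀ i → f i ≡ g i) → ∀ i → (x VecF.∷ f) i ≡ (x VecF.∷ g) i
    ∷-cong f≗g zero    = refl
    ∷-cong f≗g (suc i) = f≗g i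
... | yes ∀P = yes (λ f → resp (λ { zero → enum-index E (f zero) ; (suc i) → refl }) (∀P (index E (f zero)) (f ∘ suc)))
... | no ¬∀P = no (λ ∀P → ¬∀P (λ i g → ∀P (enum E i VecF.∷ g)))

letterCodes : ∀ k → Enumeration (Vec Bool k)
letterCodes = Vec-enumeration Bool-enumeration

count : ∀ {n} {P : Fin n → Set} → (∀ i → Dec (P i)) → ℕ
count {zero}  P? = 0
count {suc n} P? with P? zero
... | yes _ = suc (count (P? ∘ suc))
... | no _  = count (P? ∘ suc)

count-mono : ∀ {n} {P Q : Fin n → Set} (P? : ∀ i → Dec (P i)) (Q? : ∀ i → Dec (Q i)) →
  (∀ {i} → P i → Q i) → count P? ≤ count Q?
count-mono {zero}  P? Q? P⊆Q = z≤n
count-mono {suc n} P? Q? P⊆Q with P? zero | Q? zero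
... | yes _ | yes _ = s≤s (count-mono (P? ∘ suc) (Q? ∘ suc) P⊆Q)
... | yes p | no ¬q = ⊥-elim (¬q (P⊆Q p))
... | no _  | yes _ = ℕP.m≤n⇒m≤1+n (count-mono (P? ∘ suc) (Q? ∘ suc) P⊆Q)
... | no _  | no _  = count-mono (P? ∘ suc) (Q? ∘ suc) P⊆Q

count-mono-< : ∀ {n} {P Q : Fin n → Set} (P? : ∀ i → Dec (P i)) (Q? : ∀ i → Dec (Q i)) →
  (∀ {i} → P i → Q i) → ∀ i → ¬ P i → Q i → count P? < count Q?
count-mono-< P? Q? P⊆Q zero ¬p q with P? zero | Q? zero
... | yes p | _     = ⊥-elim (¬p p)
... | no _  | yes _ = s≤s (count-mono (P? ∘ suc) (Q? ∘ suc) P⊆Q)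
... | no _  | no ¬q = ⊥-elim (¬q q)
count-mono-< P? Q? P⊆Q (suc i) ¬p q with P? zero | Q? zero
... | yes _ | yes _ = s≤s (count-mono-< (P? ∘ suc) (Q? ∘ suc) P⊆Q i ¬p q)
... | yes p | no ¬q = ⊥-elim (¬q (P⊆Q p))
... | no _  | yes _ = ℕP.m<n⇒m<1+n (count-mono-< (P? ∘ suc) (Q? ∘ suc) P⊆Q i ¬p q)
... | no _  | no _  = count-mono-< (P? ∘ suc) (Q? ∘ suc) P⊆Q i ¬p q

count-cong : ∀ {n} {P Q : Fin n → Set} (P? : ∀ i → Dec (P i)) (Q? : ∀ i → Dec (Q i)) →
  (∀ {i} → P i → Q i) → (∀ {i} → Q i → P i) → count P? ≡ count Q?
count-cong P? Q? P⊆Q Q⊆P = ℕP.≤-antisym (count-mono P? Q? P⊆Q) (count-mono Q? P? Q⊆P)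

count≤n : ∀ {n} {P : Fin n → Set} (P? : ∀ i → Dec (P i)) → count P? ≤ n
count≤n {zero}  P? = z≤n
count≤n {suc n} P? with P? zero
... | yes _ = s≤s (count≤n (P? ∘ suc))
... | no _  = ℕP.m≤n⇒m≤1+n (count≤n (P? ∘ suc))

count<n : ∀ {n} {P : Fin n → Set} (P? : ∀ i → Dec (P i)) → ∀ i → ¬ P i → count P? < n
count<n {n} P? i ¬p = subst (count P? <_) (count-all n) (count-mono-< P? (λ _ → yes tt) _ i ¬p tt)
  where
    count-all : ∀ n → count {n} (λ _ → yes tt) ≡ n
    count-all zero    = refl
    count-all (suc n) = cong suc (count-all n)

count-pos : ∀ {n} {P : Fin n → Set} (P? : ∀ i → Dec (P i)) → ∀ i → P i → 0 < count P?
count-pos P? i p = ℕP.≤-<-trans z≤n (count-mono-< (λ _ → no id) P? (λ ()) i id p)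

module Rank {A : Set} {_≺_ : Rel A 0ℓ} (_≺?_ : Decidable _≺_) where

  rank : ∀ {m} → (Fin m → A) → A → ℕ
  rank η a = count (λ i → η i ≺? a)

  rank-mono : ∀ {m} (η : Fin m → A) {a a′} → (∀ {i} → η i ≺ a → η i ≺ a′) → rank η a ≤ rank η a′
  rank-mono η {a} {a′} below = count-mono (λ i → η i ≺? a) (λ i → η i ≺? a′) below

  module _ (≺-trans : ∀ {a b c} → a ≺ b → b ≺ c → a ≺ c) (≺-irrefl : ∀ {a} → ¬ a ≺ a) where

    rank-< : ∀ {m} (η : Fin m → A) i {a} → η i ≺ a → rank η (η i) < rank η a
    rank-< η i {a} ηi≺a = count-mono-< (λ j → η j ≺? η i) (λ j → η j ≺? a) (λ b≺ηi → ≺-trans b≺ηi ηi≺a) i ≺-irrefl ηi≺a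

    rank<m : ∀ {m} (η : Fin m → A) i → rank η (η i) < m
    rank<m η i = count<n (λ j → η j ≺? η i) i ≺-irrefl

module OrderType {A : Set} {_≺_ : Rel A 0ℓ} (_≺?_ : Decidable _≺_) (≺-cmp : Trichotomous _≡_ _≺_)
    (≺-trans : Transitive _≺_) (≺-irrefl : Irreflexive _≡_ _≺_) {m} (η : Fin m → A) where
  open Rank _≺?_

  orderType : Fin m → Fin m
  orderType i = fromℕ< (rank<m ≺-trans (≺-irrefl refl) η i)

  toℕ-orderType : ∀ i → toℕ (orderType i) ≡ rank η (η i)
  toℕ-orderType i = FP.toℕ-fromℕ< _

  orderType-< : ∀ {i j} → η i ≺ η j → orderType i <ᶠ orderType j
  orderType-< {i} {j} ηi≺ηj = subst₂ _<_ (sym (toℕ-orderType i)) (sym (toℕ-orderType j))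
    (rank-< ≺-trans (≺-irrefl refl) η i ηi≺ηj)

  orderType-≡ : ∀ {i j} → η i ≡ η j → orderType i ≡ orderType j
  orderType-≡ {i} {j} ηi≡ηj = FP.toℕ-injective
    (trans (toℕ-orderType i) (trans (cong (rank η) ηi≡ηj) (sym (toℕ-orderType j))))

  open Embedding ≺-cmp FP.<-irrefl FP.<-asym {ρ = η} {κ = orderType} orderType-< orderType-≡ public using ()
    renaming (<-refl to orderType-<⁻¹; ≡-refl to orderType-≡⁻¹)

⊤ᶠ ⊥ᶠ : ∀ {k V} → V → QF k V
⊤ᶠ v = eq v v
⊥ᶠ v = lt v v

-- v only serves to write ⊤ and ⊥ for the empty conjunction and disjunction.
⋀ ⋁ : ∀ {k V K} → V → (Fin K → QF k V) → QF k V
⋀ {K = zero}  v φ = ⊤ᶠ v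
⋀ {K = suc K} v φ = and (φ zero) (⋀ v (φ ∘ suc))
⋁ {K = zero}  v φ = ⊥ᶠ v
⋁ {K = suc K} v φ = or (φ zero) (⋁ v (φ ∘ suc))

All Any : ∀ {k V K} {P : Fin K → Set} → V → (∀ i → Dec (P i)) → (Fin K → QF k V) → QF k V
All v P? φ = ⋀ v (λ i → if does (P? i) then φ i else ⊤ᶠ v)
Any v P? φ = ⋁ v (λ i → if does (P? i) then φ i else ⊥ᶠ v)

⋀-negFree : ∀ {k V K} (v : V) (φ : Fin K → QF k V) → (∀ i → NegFree (φ i)) → NegFree (⋀ v φ)
⋀-negFree {K = zero}  v φ nφ = _
⋀-negFree {K = suc K} v φ nφ = nφ zero , ⋀-negFree v (φ ∘ suc) (nφ ∘ suc)

⋁-negFree : ∀ {k V K} (v : V) (φ : Fin K → QF k V) → (∀ i → NegFree (φ i)) → NegFree (⋁ v φ)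
⋁-negFree {K = zero}  v φ nφ = _
⋁-negFree {K = suc K} v φ nφ = nφ zero , ⋁-negFree v (φ ∘ suc) (nφ ∘ suc)

if-negFree : ∀ {k V} b {φ ψ : QF k V} → NegFree φ → NegFree ψ → NegFree (if b then φ else ψ)
if-negFree true  nφ nψ = nφ
if-negFree false nφ nψ = nψ

All-negFree : ∀ {k V K} {P : Fin K → Set} (v : V) (P? : ∀ i → Dec (P i)) (φ : Fin K → QF k V) →
  (∀ i → NegFree (φ i)) → NegFree (All v P? φ)
All-negFree v P? φ nφ = ⋀-negFree v _ (λ i → if-negFree (does (P? i)) (nφ i) _)

Any-negFree : ∀ {k V K} {P : Fin K → Set} (v : V) (P? : ∀ i → Dec (P i)) (φ : Fin K → QF k V) →
  (∀ i → NegFree (φ i)) → NegFree (Any v P? φ)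
Any-negFree v P? φ nφ = ⋁-negFree v _ (λ i → if-negFree (does (P? i)) (nφ i) _)

AnyOf : ∀ {k V X} {P : X → Set} → V → (E : Enumeration X) → (∀ x → Dec (P x)) → (X → QF k V) → QF k V
AnyOf v E P? φ = Any v (P? ∘ enum E) (φ ∘ enum E)

AnyOf-negFree : ∀ {k V X} {P : X → Set} (v : V) (E : Enumeration X) (P? : ∀ x → Dec (P x)) (φ : X → QF k V) →
  (∀ x → NegFree (φ x)) → NegFree (AnyOf v E P? φ)
AnyOf-negFree v E P? φ nφ = Any-negFree v (P? ∘ enum E) (φ ∘ enum E) (nφ ∘ enum E)

atLeast : ∀ {k V} → V → Letter k → V → QF k V
atLeast v ℓ y = All v (λ a → ℓ a BP.≟ true) (λ a → atom a y)

orderPattern : ∀ {k V M P} → V → (Fin M → V) → (Fin M → Fin P) → QF k V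
orderPattern v y τ = and (⋀ v (λ i → All v (λ j → τ i FP.<? τ j) (λ j → lt (y i) (y j))))
                         (⋀ v (λ i → All v (λ j → τ i FP.≟ τ j) (λ j → eq (y i) (y j))))

atLeast-negFree : ∀ {k V} (v : V) (ℓ : Letter k) y → NegFree (atLeast v ℓ y)
atLeast-negFree v ℓ y = All-negFree v (λ a → ℓ a BP.≟ true) (λ a → atom a y) _

orderPattern-negFree : ∀ {k V M P} (v : V) (y : Fin M → V) (τ : Fin M → Fin P) → NegFree {k} (orderPattern v y τ)
orderPattern-negFree v y τ =
  ⋀-negFree v _ (λ i → All-negFree v (λ j → τ i FP.<? τ j) (λ j → lt (y i) (y j)) _) ,
  ⋀-negFree v _ (λ i → All-negFree v (λ j → τ i FP.≟ τ j) (λ j → eq (y i) (y j)) _)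

Follows : ∀ {k V M P} → Structure k V → (Fin M → V) → (Fin M → Fin P) → Set
Follows T y τ = (∀ i j → τ i <ᶠ τ j → Less T (y i) (y j)) × (∀ i j → τ i ≡ τ j → Same T (y i) (y j))

module Connectives {k V} {T : Structure k V} {v : V} (v≈v : Same T v v) (v≮v : ¬ Less T v v) where

  ⋀-⇔ : ∀ {K} (φ : Fin K → QF k V) → T ⊩ ⋀ v φ ⇔ (∀ i → T ⊩ φ i)
  ⋀-⇔ {zero}  φ = mk⇔ (λ _ ()) (λ _ → v≈v)
  ⋀-⇔ {suc K} φ = mk⇔
    (λ { (h , hs) zero → h ; (h , hs) (suc i) → Equivalence.to (⋀-⇔ (φ ∘ suc)) hs i })
    (λ h → h zero , Equivalence.from (⋀-⇔ (φ ∘ suc)) (h ∘ suc))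

  ⋁-⇔ : ∀ {K} (φ : Fin K → QF k V) → T ⊩ ⋁ v φ ⇔ ∃ λ i → T ⊩ φ i
  ⋁-⇔ {zero}  φ = mk⇔ (⊥-elim ∘ v≮v) (λ ())
  ⋁-⇔ {suc K} φ = mk⇔
    (λ { (inj₁ h) → zero , h ; (inj₂ h) → let (i , h′) = Equivalence.to (⋁-⇔ (φ ∘ suc)) h in suc i , h′ })
    (λ { (zero , h) → inj₁ h ; (suc i , h) → inj₂ (Equivalence.from (⋁-⇔ (φ ∘ suc)) (i , h)) })

  private
    when-⊤-⇔ : ∀ {P : Set} (P? : Dec P) φ → T ⊩ (if does P? then φ else ⊤ᶠ v) ⇔ (P → T ⊩ φ)
    when-⊤-⇔ (yes p) φ = mk⇔ (λ h _ → h) (λ h → h p)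
    when-⊤-⇔ (no ¬p) φ = mk⇔ (λ _ p → ⊥-elim (¬p p)) (λ _ → v≈v)

    when-⊥-⇔ : ∀ {P : Set} (P? : Dec P) φ → T ⊩ (if does P? then φ else ⊥ᶠ v) ⇔ (P × T ⊩ φ)
    when-⊥-⇔ (yes p) φ = mk⇔ (p ,_) proj₂
    when-⊥-⇔ (no ¬p) φ = mk⇔ (⊥-elim ∘ v≮v) (⊥-elim ∘ ¬p ∘ proj₁)

  All-⇔ : ∀ {K} {P : Fin K → Set} (P? : ∀ i → Dec (P i)) φ → T ⊩ All v P? φ ⇔ (∀ i → P i → T ⊩ φ i)
  All-⇔ P? φ = mk⇔
    (λ h i → Equivalence.to (when-⊤-⇔ (P? i) (φ i)) (Equivalence.to (⋀-⇔ _) h i))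
    (λ h → Equivalence.from (⋀-⇔ _) (λ i → Equivalence.from (when-⊤-⇔ (P? i) (φ i)) (h i)))

  Any-⇔ : ∀ {K} {P : Fin K → Set} (P? : ∀ i → Dec (P i)) φ → T ⊩ Any v P? φ ⇔ ∃ λ i → P i × T ⊩ φ i
  Any-⇔ P? φ = mk⇔
    (λ h → let (i , h′) = Equivalence.to (⋁-⇔ _) h in i , Equivalence.to (when-⊥-⇔ (P? i) (φ i)) h′)
    (λ (i , h) → Equivalence.from (⋁-⇔ _) (i , Equivalence.from (when-⊥-⇔ (P? i) (φ i)) h))

  AnyOf-⇔ : ∀ {X} {P : X → Set} (E : Enumeration X) (P? : ∀ x → Dec (P x)) φ →
    T ⊩ AnyOf v E P? φ ⇔ ∃ λ x → P x × T ⊩ φ x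
  AnyOf-⇔ {P = P} E P? φ = mk⇔
    (λ h → let (i , p , h′) = Equivalence.to (Any-⇔ (P? ∘ enum E) (φ ∘ enum E)) h in enum E i , p , h′)
    (λ (x , p , h) → Equivalence.from (Any-⇔ (P? ∘ enum E) (φ ∘ enum E))
       (index E x , subst (λ y → P y × T ⊩ φ y) (sym (enum-index E x)) (p , h)))

  atLeast-⇔ : ∀ (ℓ : Letter k) y → T ⊩ atLeast v ℓ y ⇔ ℓ ⊆ᴬ label T y
  atLeast-⇔ ℓ y = All-⇔ (λ a → ℓ a BP.≟ true) (λ a → atom a y)

  orderPattern-⇔ : ∀ {M P} (y : Fin M → V) (τ : Fin M → Fin P) → T ⊩ orderPattern v y τ ⇔ Follows T y τ
  orderPattern-⇔ y τ = mk⇔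
    (λ (h< , h≡) → (λ i → Equivalence.to (All-⇔ (τ<? i) (yLt i)) (Equivalence.to (⋀-⇔ _) h< i))
                 , (λ i → Equivalence.to (All-⇔ (τ≟ i) (yEq i)) (Equivalence.to (⋀-⇔ _) h≡ i)))
    (λ (h< , h≡) → Equivalence.from (⋀-⇔ _) (λ i → Equivalence.from (All-⇔ (τ<? i) (yLt i)) (h< i))
                 , Equivalence.from (⋀-⇔ _) (λ i → Equivalence.from (All-⇔ (τ≟ i) (yEq i)) (h≡ i)))
    where
      τ<? = λ i j → τ i FP.<? τ j
      τ≟ = λ i j → τ i FP.≟ τ j
      yLt = λ i j → lt (y i) (y j)
      yEq = λ i j → eq (y i) (y j)

-- Every formula mentions a variable; it serves as the dummy variable of ⋀ and ⋁.
someVar : ∀ {k V} → QF k V → V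
someVar (atom _ x) = x
someVar (lt x _)   = x
someVar (le x _)   = x
someVar (eq x _)   = x
someVar (neq x _)  = x
someVar (neg φ)    = someVar φ
someVar (and φ _)  = someVar φ
someVar (or φ _)   = someVar φ

module WithoutExistentials {k m} (ψ : QF k (Fin 0 ⊎ Fin m)) {L : Language k} (mon : Monotone L)
    (def : Defines (∃∀ 0 m ψ) L) where

  Var : Set
  Var = Fin 0 ⊎ Fin m

  universal : Var → Fin m
  universal (inj₂ j) = j

  v₀ : Var
  v₀ = someVar ψ

  -- An order type of m positions together with the letters at these positions.
  TupleType : Set
  TupleType = Vec (Fin m) m × Vec (Vec Bool k) m

  tupleTypes : Enumeration TupleType
  tupleTypes = ×-enumeration (Vec-enumeration (Fin-enumeration m) m) (Vec-enumeration (letterCodes k) m)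

  shape : (Fin m → Fin m) → (Fin m → Vec Bool k) → Structure k Var
  shape τ ℓ = induced _<ᶠ_ (τ ∘ universal) (Vec.lookup ∘ ℓ ∘ universal)

  GoodFor : TupleType → (Fin m → Vec Bool k) → Set
  GoodFor (τ , c) ℓ = (∀ i → Vec.lookup (Vec.lookup c i) ⊆ᴬ Vec.lookup (ℓ i)) →
                      (∀ i j → Vec.lookup τ i ≡ Vec.lookup τ j → ℓ i ≡ ℓ j) → shape (Vec.lookup τ) ℓ ⊩ ψ

  Good : TupleType → Set
  Good t = ∀ ℓ → GoodFor t ℓ

  Good? : ∀ t → Dec (Good t)
  Good? (τ , c) = ∀-dec (letterCodes k) m GoodFor?
    λ ℓ≗ℓ′ good c⊆ℓ′ consistent′ → Equivalence.to
      (Embedding.induced-⇔ FP.<-cmp FP.<-irrefl FP.<-asym id id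
        (λ x a → cong (λ ℓ → Vec.lookup ℓ a) (ℓ≗ℓ′ (universal x))) ψ)
      (good (λ i a → subst (λ ℓ → Vec.lookup ℓ a ≡ true) (sym (ℓ≗ℓ′ i)) ∘ c⊆ℓ′ i a)
            (λ i j e → trans (ℓ≗ℓ′ i) (trans (consistent′ i j e) (sym (ℓ≗ℓ′ j)))))
    where
      GoodFor? : ∀ ℓ → Dec (GoodFor (τ , c) ℓ)
      GoodFor? ℓ =
        FP.all? (λ i → FP.all? (λ a → (Vec.lookup (Vec.lookup c i) a BP.≟ true) →-dec (Vec.lookup (ℓ i) a BP.≟ true)))
        →-dec FP.all? (λ i → FP.all? (λ j → (Vec.lookup τ i FP.≟ Vec.lookup τ j) →-dec VP.≡-dec BP._≟_ (ℓ i) (ℓ j)))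
        →-dec induced-dec FP._<?_ FP._≟_ _ _ ψ

  typeFormula : TupleType → QF k Var
  typeFormula (τ , c) = and (orderPattern v₀ inj₂ (Vec.lookup τ))
                            (⋀ v₀ (λ i → atLeast v₀ (Vec.lookup (Vec.lookup c i)) (inj₂ i)))

  ψ⁺ : QF k Var
  ψ⁺ = AnyOf v₀ tupleTypes Good? typeFormula

  ψ⁺-negFree : NegFree ψ⁺
  ψ⁺-negFree = AnyOf-negFree v₀ tupleTypes Good? typeFormula
    (λ (τ , c) → orderPattern-negFree v₀ inj₂ (Vec.lookup τ) ,
                 ⋀-negFree v₀ _ (λ i → atLeast-negFree v₀ (Vec.lookup (Vec.lookup c i)) (inj₂ i)))

  module AtTuple (w : Word k) (ξ : Fin 0 → Pos w) (η : Fin m → Pos w) where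

    T : Structure k Var
    T = positions w [ ξ , η ]

    open Connectives {T = T} {v = v₀} refl (FP.<-irrefl refl)

    HasType : TupleType → Set
    HasType (τ , c) = Follows T inj₂ (Vec.lookup τ) × (∀ i → Vec.lookup (Vec.lookup c i) ⊆ᴬ lookup w (η i))

    ψ⁺-⇔ : T ⊩ ψ⁺ ⇔ ∃ λ t → Good t × HasType t
    ψ⁺-⇔ = mk⇔
      (λ h → let (t , good , h′) = Equivalence.to (AnyOf-⇔ tupleTypes Good? typeFormula) h in t , good , typeFormula⇒ t h′)
      (λ (t , good , has) → Equivalence.from (AnyOf-⇔ tupleTypes Good? typeFormula) (t , good , ⇒typeFormula t has))
      where
        atLeasts-⇔ : ∀ (c : Vec (Vec Bool k) m) →
          T ⊩ ⋀ v₀ (λ i → atLeast v₀ (Vec.lookup (Vec.lookup c i)) (inj₂ i)) ⇔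
          (∀ i → Vec.lookup (Vec.lookup c i) ⊆ᴬ lookup w (η i))
        atLeasts-⇔ c = mk⇔
          (λ h i → Equivalence.to (atLeast-⇔ (Vec.lookup (Vec.lookup c i)) (inj₂ i)) (Equivalence.to (⋀-⇔ _) h i))
          (λ h → Equivalence.from (⋀-⇔ _) (λ i → Equivalence.from (atLeast-⇔ (Vec.lookup (Vec.lookup c i)) (inj₂ i)) (h i)))
        typeFormula⇒ : ∀ t → T ⊩ typeFormula t → HasType t
        typeFormula⇒ (τ , c) (h , h′) =
          Equivalence.to (orderPattern-⇔ inj₂ (Vec.lookup τ)) h , Equivalence.to (atLeasts-⇔ c) h′
        ⇒typeFormula : ∀ t → HasType t → T ⊩ typeFormula t
        ⇒typeFormula (τ , c) (h , h′) =
          Equivalence.from (orderPattern-⇔ inj₂ (Vec.lookup τ)) h , Equivalence.from (atLeasts-⇔ c) h′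

    good-type⇒ψ : ∀ t → Good t → HasType t → T ⊩ ψ
    good-type⇒ψ (τ , c) good ((η< , η≡) , c⊆w) = Equivalence.to
      (Embedding.induced-⇔ FP.<-cmp FP.<-irrefl FP.<-asym
        (λ { {inj₂ i} {inj₂ j} → η< i j }) (λ { {inj₂ i} {inj₂ j} → η≡ i j }) labels ψ)
      (good ℓ (λ i a → subst (_≡ true) (sym (VP.lookup∘tabulate _ a)) ∘ c⊆w i a)
              (λ i j e → cong (Vec.tabulate ∘ lookup w) (η≡ i j e)))
      where
        ℓ : Fin m → Vec Bool k
        ℓ = Vec.tabulate ∘ lookup w ∘ η
        labels : ∀ x a → Vec.lookup (ℓ (universal x)) a ≡ lookup w ([ ξ , η ] x) a
        labels (inj₂ j) a = VP.lookup∘tabulate _ a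

  sound : ∀ w → w ⊨ ∃∀ 0 m ψ⁺ → w ⊨ ∃∀ 0 m ψ
  sound w (ξ , ⊨ψ⁺) = ξ , λ η →
    let open AtTuple w ξ η
        (t , good , has) = Equivalence.to ψ⁺-⇔ (Equivalence.to (evalQF⇔positions w _ ψ⁺) (⊨ψ⁺ η))
    in Equivalence.from (evalQF⇔positions w _ ψ) (good-type⇒ψ t good has)

  module _ (w : Word k) (Lw : L w) (η : Fin m → Pos w) where
    open OrderType FP._<?_ FP.<-cmp FP.<-trans FP.<-irrefl η
    open AtTuple w (λ ()) η

    type₀ : TupleType
    type₀ = Vec.tabulate orderType , Vec.tabulate (Vec.tabulate ∘ lookup w ∘ η)

    τ₀ : Fin m → Fin m
    τ₀ = Vec.lookup (proj₁ type₀)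

    τ₀≡ : ∀ i → τ₀ i ≡ orderType i
    τ₀≡ = VP.lookup∘tabulate orderType

    letters₀ : ∀ i a → Vec.lookup (Vec.lookup (proj₂ type₀) i) a ≡ lookup w (η i) a
    letters₀ i a = trans (cong (λ ℓ → Vec.lookup ℓ a) (VP.lookup∘tabulate _ i)) (VP.lookup∘tabulate _ a)

    has₀ : HasType type₀
    has₀ = ( (λ i j τi<τj → orderType-<⁻¹ (subst₂ _<ᶠ_ (τ₀≡ i) (τ₀≡ j) τi<τj))
           , (λ i j τi≡τj → orderType-≡⁻¹ (trans (sym (τ₀≡ i)) (trans τi≡τj (τ₀≡ j)))) )
         , λ i a → subst (_≡ true) (letters₀ i a)

    -- Raising the letters at η to any consistent ℓ stays in L by monotonicity.
    good₀ : Good type₀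
    good₀ ℓ c⊆ℓ consistent = Equivalence.to
      (Embedding.induced-⇔ FP.<-cmp FP.<-irrefl FP.<-asym
        (λ { {inj₂ i} {inj₂ j} ηi<ηj → subst₂ _<ᶠ_ (sym (τ₀≡ i)) (sym (τ₀≡ j)) (orderType-< ηi<ηj) })
        (λ { {inj₂ i} {inj₂ j} ηi≡ηj → trans (τ₀≡ i) (trans (orderType-≡ ηi≡ηj) (sym (τ₀≡ j))) })
        (λ { (inj₂ j) a → raised-at-η j a })
        ψ)
      (Equivalence.to (relabel-⇔ w raised (η ∘ universal) [ proj₁ w′⊨ψ , η′ ] (λ { (inj₂ j) → FP.toℕ-cast _ (η j) }) ψ)
        (Equivalence.to (evalQF⇔positions w′ _ ψ) (proj₂ w′⊨ψ η′)))
      where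
        raised : Pos w → Letter k
        raised p with FP.any? (λ j → η j FP.≟ p)
        ... | yes (j , _) = Vec.lookup (ℓ j)
        ... | no _        = lookup w p
        raised-⊇ : ∀ p → lookup w p ⊆ᴬ raised p
        raised-⊇ p with FP.any? (λ j → η j FP.≟ p)
        ... | yes (j , refl) = λ a → c⊆ℓ j a ∘ subst (_≡ true) (sym (letters₀ j a))
        ... | no _           = λ _ → id
        raised-at-η : ∀ j a → raised (η j) a ≡ Vec.lookup (ℓ j) a
        raised-at-η j a with FP.any? (λ j′ → η j′ FP.≟ η j)
        ... | yes (j′ , ηj′≡ηj) = cong (λ ℓ → Vec.lookup ℓ a)
                                   (consistent j′ j (trans (τ₀≡ j′) (trans (orderType-≡ ηj′≡ηj) (sym (τ₀≡ j)))))
        ... | no ∄j = ⊥-elim (∄j (j , refl))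
        w′ : Word k
        w′ = relabel w raised
        w′⊨ψ : w′ ⊨ ∃∀ 0 m ψ
        w′⊨ψ = Equivalence.to (def w′) (mon w w′ Lw (≤ᵂ-relabel w raised raised-⊇))
        η′ : Fin m → Pos w′
        η′ = cast (sym (length-relabel w raised)) ∘ η

  complete : ∀ w → L w → w ⊨ ∃∀ 0 m ψ⁺
  complete w Lw = (λ ()) , λ η → Equivalence.from (evalQF⇔positions w _ ψ⁺)
    (Equivalence.from (AtTuple.ψ⁺-⇔ w (λ ()) η) (type₀ w Lw η , good₀ w Lw η , has₀ w Lw η))

  definable⁺ : Σ₂⁺-definable L
  definable⁺ = ∃∀ 0 m ψ⁺ , ψ⁺-negFree , λ w → mk⇔ (complete w) (Equivalence.from (def w) ∘ sound w)

first-transition : ∀ {P : ℕ → Set} → (∀ n → Dec (P n)) → ∀ {a b} → a ≤ b → ¬ P a → P b →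
  ∃ λ e → a ≤ e × e < b × ¬ P e × P (suc e)
first-transition P? {a} {zero} a≤0 ¬Pa Pb with ℕP.n≤0⇒n≡0 a≤0
... | refl = ⊥-elim (¬Pa Pb)
first-transition {P} P? {a} {suc b} a≤1+b ¬Pa P1+b = step (P? b)
  where
    a≤b : a ≤ b
    a≤b = ℕP.≤-pred (ℕP.≤∧≢⇒< a≤1+b (λ { refl → ¬Pa P1+b }))
    step : Dec (P b) → ∃ λ e → a ≤ e × e < suc b × ¬ P e × P (suc e)
    step (no ¬Pb) = b , a≤b , ℕP.n<1+n b , ¬Pb , P1+b
    step (yes Pb) = let (e , a≤e , e<b , ¬Pe , P1+e) = first-transition P? a≤b ¬Pa Pb in
                    e , a≤e , ℕP.m<n⇒m<1+n e<b , ¬Pe , P1+e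

-- With s letters the greedy factorization cuts at most m segments, each marked at its end and
-- refined with one letter less, and refines the rest; each forced position splits in two.
freeBound : ℕ → ℕ → ℕ
freeBound m zero    = 0
freeBound m (suc s) = m + suc m * freeBound m s

factorBound : ℕ → ℕ → ℕ → ℕ
factorBound m NL zero    = freeBound m NL
factorBound m NL (suc c) = factorBound m NL c + factorBound m NL c

-- Positions are natural numbers labelled by lab, and the positions forced must be marked.
-- A factorization of [lo, hi) marks boundedly many further positions so that every maximal
-- unmarked block is rich: it splits into m consecutive segments each containing every letter
-- of the block.
module Factorization (m : ℕ) {NL : ℕ} (lab : ℕ → Fin NL) {n : ℕ} (forced : Fin n → ℕ) where

  Occurs : Fin NL → ℕ → ℕ → Set
  Occurs x a b = ∃ λ q → a ≤ q × q < b × lab q ≡ x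

  occurs? : ∀ x a b → Dec (Occurs x a b)
  occurs? x a b = Dec.map′
    (λ (i , a≤i , e) → toℕ i , a≤i , FP.toℕ<n i , e)
    (λ (q , a≤q , q<b , e) → fromℕ< q<b , subst (a ≤_) (sym (FP.toℕ-fromℕ< q<b)) a≤q
                           , subst (λ r → lab r ≡ x) (sym (FP.toℕ-fromℕ< q<b)) e)
    (FP.any? {b} (λ i → (a ℕP.≤? toℕ i) ×-dec (lab (toℕ i) FP.≟ x)))

  LetterSet : Set
  LetterSet = Fin NL → Bool

  Full : LetterSet → ℕ → ℕ → Set
  Full S a b = ∀ x → S x ≡ true → Occurs x a b

  Full? : ∀ S a b → Dec (Full S a b)
  Full? S a b = FP.all? (λ x → (S x BP.≟ true) →-dec occurs? x a b)

  missing : ∀ S a b → ¬ Full S a b → ∃ λ x → S x ≡ true × ¬ Occurs x a b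
  missing S a b ¬full with FP.¬∀⟶∃¬ NL _ (λ x → (S x BP.≟ true) →-dec occurs? x a b) ¬full
  ... | x , ¬[x∈S→occ] with S x BP.≟ true
  ...   | yes x∈S = x , x∈S , λ occ → ¬[x∈S→occ] (λ _ → occ)
  ...   | no x∉S  = ⊥-elim (¬[x∈S→occ] (λ x∈S → ⊥-elim (x∉S x∈S)))

  ∣_∣ : LetterSet → ℕ
  ∣ S ∣ = count (λ x → S x BP.≟ true)

  _∖_ : LetterSet → Fin NL → LetterSet
  (S ∖ x) y = S y ∧ not (does (y FP.≟ x))

  ∣S∖x∣<∣S∣ : ∀ S x → S x ≡ true → ∣ S ∖ x ∣ < ∣ S ∣
  ∣S∖x∣<∣S∣ S x x∈S = count-mono-< _ _ (λ {y} → ∖⊆ y) x x∉S∖x x∈S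
    where
      ∖⊆ : ∀ y → (S ∖ x) y ≡ true → S y ≡ true
      ∖⊆ y with S y
      ... | true  = λ _ → refl
      ... | false = λ ()
      x∉S∖x : ¬ (S ∖ x) x ≡ true
      x∉S∖x with x FP.≟ x
      ... | yes _   rewrite BP.∧-zeroʳ (S x) = λ ()
      ... | no x≢x = ⊥-elim (x≢x refl)

  ∈-∖ : ∀ S x y → S y ≡ true → y ≢ x → (S ∖ x) y ≡ true
  ∈-∖ S x y y∈S y≢x with y FP.≟ x
  ... | yes y≡x = ⊥-elim (y≢x y≡x)
  ... | no _    rewrite y∈S = refl

  record Rich (s e : ℕ) : Set where
    field
      cut      : ℕ → ℕ
      s≤cut₀   : s ≤ cut 0
      cut-step : ∀ t → t < m → cut t ≤ cut (suc t)
      cutₘ≤e   : cut m ≤ e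
      occurs   : ∀ t → t < m → ∀ q → s ≤ q → q < e → Occurs (lab q) (cut t) (cut (suc t))

    cut-mono : ∀ {a b} → a ≤ b → b ≤ m → cut a ≤ cut b
    cut-mono {a} {zero} a≤0 _ with ℕP.n≤0⇒n≡0 a≤0
    ... | refl = ℕP.≤-refl
    cut-mono {a} {suc b} a≤1+b b<m with ℕP.m≤n⇒m<n∨m≡n a≤1+b
    ... | inj₂ refl  = ℕP.≤-refl
    ... | inj₁ a<1+b = ℕP.≤-trans (cut-mono (ℕP.≤-pred a<1+b) (ℕP.<⇒≤ b<m)) (cut-step b b<m)

  Forced : ℕ → Set
  Forced q = ∃ λ i → forced i ≡ q

  Marked : List ℕ → ℕ → Set
  Marked marks q = q ∈ marks ⊎ Forced q

  record Block (M : ℕ → Set) (lo hi p : ℕ) : Set where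
    field
      start end     : ℕ
      lo≤start      : lo ≤ start
      start≤p       : start ≤ p
      p<end         : p < end
      end≤hi        : end ≤ hi
      unmarked      : ∀ q → start ≤ q → q < end → ¬ M q
      left-bounded  : start ≡ lo ⊎ ∃ λ s → start ≡ suc s × lo ≤ s × M s
      right-bounded : end ≡ hi ⊎ end < hi × M end
      rich          : Rich start end

  Blocks : (ℕ → Set) → ℕ → ℕ → Set
  Blocks M lo hi = ∀ p → lo ≤ p → p < hi → ¬ M p → Block M lo hi p

  blocks-empty : ∀ {M} lo hi → hi ≤ lo → Blocks M lo hi
  blocks-empty lo hi hi≤lo p lo≤p p<hi = ⊥-elim (ℕP.<-irrefl refl (ℕP.<-≤-trans p<hi (ℕP.≤-trans hi≤lo lo≤p)))

  blocks-rich : ∀ {M} lo hi → Rich lo hi → (∀ q → lo ≤ q → q < hi → ¬ M q) → Blocks M lo hi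
  blocks-rich lo hi rich unmarked p lo≤p p<hi _ = record
    { start = lo ; end = hi ; lo≤start = ℕP.≤-refl ; start≤p = lo≤p ; p<end = p<hi ; end≤hi = ℕP.≤-refl
    ; unmarked = unmarked ; left-bounded = inj₁ refl ; right-bounded = inj₁ refl ; rich = rich }

  blocks-join : ∀ {M M₁ M₂ : ℕ → Set} {lo f hi} → lo ≤ f → f < hi → M f →
    (∀ {q} → q < f → M₁ q → M q) → (∀ {q} → lo ≤ q → q < f → M q → M₁ q) →
    (∀ {q} → f < q → M₂ q → M q) → (∀ {q} → f < q → q < hi → M q → M₂ q) →
    Blocks M₁ lo f → Blocks M₂ (suc f) hi → Blocks M lo hi
  blocks-join {M} {M₁} {M₂} {lo} {f} {hi} lo≤f f<hi Mf M₁⇒M M⇒M₁ M₂⇒M M⇒M₂ left right p lo≤p p<hi ¬Mp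
    with ℕP.<-cmp p f
  ... | tri≈ _ refl _ = ⊥-elim (¬Mp Mf)
  ... | tri< p<f _ _ = record
    { start = start ; end = end ; lo≤start = lo≤start ; start≤p = start≤p ; p<end = p<end
    ; end≤hi = ℕP.≤-trans end≤hi (ℕP.<⇒≤ f<hi)
    ; unmarked = λ q s≤q q<e → unmarked q s≤q q<e ∘ M⇒M₁ (ℕP.≤-trans lo≤start s≤q) (ℕP.<-≤-trans q<e end≤hi)
    ; left-bounded = Sum.map₂ (λ (s , e , lo≤s , M₁s) → s , e , lo≤s , M₁⇒M (s<f s e) M₁s) left-bounded
    ; right-bounded = inj₂ ([ (λ e≡f → subst (_< hi) (sym e≡f) f<hi , subst M (sym e≡f) Mf)
                            , (λ (e<f , M₁e) → ℕP.<-trans e<f f<hi , M₁⇒M e<f M₁e) ]′ right-bounded)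
    ; rich = rich }
    where
      open Block (left p lo≤p p<f (¬Mp ∘ M₁⇒M p<f))
      s<f : ∀ s → start ≡ suc s → s < f
      s<f s start≡1+s = ℕP.≤-trans (subst (_≤ p) start≡1+s start≤p) (ℕP.<⇒≤ (ℕP.<-≤-trans p<end end≤hi))
  ... | tri> _ _ f<p = record
    { start = start ; end = end ; lo≤start = ℕP.≤-trans lo≤f (ℕP.≤-trans (ℕP.n≤1+n f) lo≤start)
    ; start≤p = start≤p ; p<end = p<end ; end≤hi = end≤hi
    ; unmarked = λ q s≤q q<e → unmarked q s≤q q<e ∘ M⇒M₂ (ℕP.<-≤-trans (s≤s ℕP.≤-refl) (ℕP.≤-trans lo≤start s≤q))
                                                         (ℕP.<-≤-trans q<e end≤hi)
    ; left-bounded = inj₂ ([ (λ e → f , e , lo≤f , Mf)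
                           , (λ (s , e , f<s , M₂s) → s , e , ℕP.≤-trans lo≤f (ℕP.<⇒≤ f<s) , M₂⇒M f<s M₂s) ]′ left-bounded)
    ; right-bounded = Sum.map₂ (λ (e<hi , M₂e) → e<hi , M₂⇒M (ℕP.<-≤-trans f<p (ℕP.<⇒≤ p<end)) M₂e) right-bounded
    ; rich = rich }
    where open Block (right p f<p p<hi (¬Mp ∘ M₂⇒M f<p))

  record Factorization (lo hi bound : ℕ) : Set where
    field
      marks   : List ℕ
      length≤ : length marks ≤ bound
      within  : ∀ q → q ∈ marks → lo ≤ q × q < hi
      blocks  : Blocks (Marked marks) lo hi

  open Factorization

  trivial : ∀ {lo hi b} → hi ≤ lo → Factorization lo hi b
  trivial {lo} {hi} hi≤lo = record { marks = [] ; length≤ = z≤n ; within = λ _ () ; blocks = blocks-empty lo hi hi≤lo }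

  weaken : ∀ {lo hi b b′} → b ≤ b′ → Factorization lo hi b → Factorization lo hi b′
  weaken b≤b′ F = record { marks = marks F ; length≤ = ℕP.≤-trans (length≤ F) b≤b′ ; within = within F ; blocks = blocks F }

  -- new is [] if f is forced and f ∷ [] otherwise.
  join : ∀ {lo f hi b₁ b₂} (new : List ℕ) → (∀ {q} → q ∈ new → q ≡ f) → Marked new f → lo ≤ f → f < hi →
    Factorization lo f b₁ → Factorization (suc f) hi b₂ → Factorization lo hi (length new + (b₁ + b₂))
  join {lo} {f} {hi} new only-f f-marked lo≤f f<hi F₁ F₂ = record
    { marks   = new ++ (marks F₁ ++ marks F₂)
    ; length≤ = subst (_≤ _) (sym (trans (LP.length-++ new) (cong (length new +_) (LP.length-++ (marks F₁)))))
                  (ℕP.+-mono-≤ (ℕP.≤-refl {length new}) (ℕP.+-mono-≤ (length≤ F₁) (length≤ F₂)))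
    ; within  = λ q q∈ → [ (λ { refl → lo≤f , f<hi })
                         , [ (λ q∈₁ → Product.map₂ (λ q<f → ℕP.<-trans q<f f<hi) (within F₁ q q∈₁))
                           , (λ q∈₂ → Product.map₁ (λ f<q → ℕP.≤-trans lo≤f (ℕP.<⇒≤ f<q)) (within F₂ q q∈₂)) ]′ ]′
                         (locate q∈)
    ; blocks  = blocks-join lo≤f f<hi (Sum.map₁ ∈.∈-++⁺ˡ f-marked)
                  (λ _ → Sum.map₁ (∈.∈-++⁺ʳ new ∘ ∈.∈-++⁺ˡ)) (λ _ → left-marks)
                  (λ _ → Sum.map₁ (∈.∈-++⁺ʳ new ∘ ∈.∈-++⁺ʳ (marks F₁))) (λ f<q _ → right-marks f<q)
                  (blocks F₁) (blocks F₂) }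
    where
      locate : ∀ {q} → q ∈ new ++ (marks F₁ ++ marks F₂) → q ≡ f ⊎ q ∈ marks F₁ ⊎ q ∈ marks F₂
      locate q∈ = Sum.map only-f (∈.∈-++⁻ (marks F₁)) (∈.∈-++⁻ new q∈)
      left-marks : ∀ {q} → q < f → Marked (new ++ (marks F₁ ++ marks F₂)) q → Marked (marks F₁) q
      left-marks {q} q<f (inj₂ forced) = inj₂ forced
      left-marks {q} q<f (inj₁ q∈) with locate q∈
      ... | inj₁ refl        = ⊥-elim (ℕP.<-irrefl refl q<f)
      ... | inj₂ (inj₁ q∈₁) = inj₁ q∈₁
      ... | inj₂ (inj₂ q∈₂) = ⊥-elim (ℕP.<-asym q<f (proj₁ (within F₂ q q∈₂)))
      right-marks : ∀ {q} → f < q → Marked (new ++ (marks F₁ ++ marks F₂)) q → Marked (marks F₂) q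
      right-marks {q} f<q (inj₂ forced) = inj₂ forced
      right-marks {q} f<q (inj₁ q∈) with locate q∈
      ... | inj₁ refl        = ⊥-elim (ℕP.<-irrefl refl f<q)
      ... | inj₂ (inj₁ q∈₁) = ⊥-elim (ℕP.<-asym f<q (proj₂ (within F₁ q q∈₁)))
      ... | inj₂ (inj₂ q∈₂) = inj₁ q∈₂

  NoForced : ℕ → ℕ → Set
  NoForced lo hi = ∀ q → lo ≤ q → q < hi → ¬ Forced q

  -- Greedily cut [st, hi) into segments that are minimal among those containing all of S;
  -- an interval that is not full has a smaller alphabet and is factorized recursively.
  module Greedy (s : ℕ) (S : LetterSet) (hi : ℕ) (∣S∣≤1+s : ∣ S ∣ ≤ suc s) (x₀ : Fin NL) (x₀∈S : S x₀ ≡ true)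
      (recurse : ∀ S′ lo′ hi′ → ∣ S′ ∣ ≤ s → (∀ q → lo′ ≤ q → q < hi′ → S′ (lab q) ≡ true) → NoForced lo′ hi′ →
                 Factorization lo′ hi′ (freeBound m s)) where

    FullSegments : ℕ → ℕ → Set
    FullSegments r st = Σ (ℕ → ℕ) λ c → c 0 ≡ st × (∀ t → t < r → c t ≤ c (suc t) × Full S (c t) (c (suc t))) × c r ≤ hi

    refine : ∀ a b → ¬ Full S a b → (∀ q → a ≤ q → q < b → S (lab q) ≡ true) → NoForced a b →
      Factorization a b (freeBound m s)
    refine a b ¬full inS noForced =
      let (x , x∈S , ¬occ) = missing S a b ¬full in
      recurse (S ∖ x) a b (ℕP.≤-pred (ℕP.<-≤-trans (∣S∖x∣<∣S∣ S x x∈S) ∣S∣≤1+s))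
        (λ q a≤q q<b → ∈-∖ S x (lab q) (inS q a≤q q<b) (λ e → ¬occ (q , a≤q , q<b , e))) noForced

    empty-not-full : ∀ a → ¬ Full S a a
    empty-not-full a full = let (_ , a≤q , q<a , _) = full x₀ x₀∈S in ℕP.<-irrefl refl (ℕP.≤-<-trans a≤q q<a)

    segments : ∀ r st → st ≤ hi → (∀ q → st ≤ q → q < hi → S (lab q) ≡ true) → NoForced st hi →
      FullSegments r st ⊎ Factorization st hi (r + suc r * freeBound m s)
    segments zero st st≤hi inS noForced = inj₁ ((λ _ → st) , refl , (λ _ ()) , st≤hi)
    segments (suc r) st st≤hi inS noForced with Full? S st hi
    ... | no ¬full = inj₂ (weaken (ℕP.m≤n+m _ (suc r)) (weaken (ℕP.m≤m+n _ _) (refine st hi ¬full inS noForced)))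
    ... | yes full with first-transition (Full? S st) st≤hi (empty-not-full st) full
    ...   | e , st≤e , e<hi , ¬full-e , full-1+e
            with segments r (suc e) e<hi (λ q 1+e≤q → inS q (ℕP.≤-trans st≤e (ℕP.≤-trans (ℕP.n≤1+n e) 1+e≤q)))
                                         (λ q 1+e≤q → noForced q (ℕP.≤-trans st≤e (ℕP.≤-trans (ℕP.n≤1+n e) 1+e≤q)))
    ...     | inj₁ (c , c₀≡1+e , segs , c≤hi) = inj₁ (c′ , refl , segs′ , c≤hi)
      where
        c′ : ℕ → ℕ
        c′ zero    = st
        c′ (suc t) = c t
        segs′ : ∀ t → t < suc r → c′ t ≤ c′ (suc t) × Full S (c′ t) (c′ (suc t))
        segs′ zero    _         = subst (st ≤_) (sym c₀≡1+e) (ℕP.m≤n⇒m≤1+n st≤e) , subst (Full S st) (sym c₀≡1+e) full-1+e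
        segs′ (suc t) (s≤s t<r) = segs t t<r
    ...     | inj₂ F = inj₂ (subst (Factorization st hi) (bound-step (freeBound m s) r)
                               (join (e ∷ []) (λ { (here refl) → refl }) (inj₁ (here refl)) st≤e e<hi
                                 (refine st e ¬full-e (λ q st≤q q<e → inS q st≤q (ℕP.<-trans q<e e<hi))
                                                      (λ q st≤q q<e → noForced q st≤q (ℕP.<-trans q<e e<hi)))
                                 F))
      where
        bound-step : ∀ b r → 1 + (b + (r + suc r * b)) ≡ suc r + suc (suc r) * b
        bound-step = solve 2 (λ b r → con 1 :+ (b :+ (r :+ (con 1 :+ r) :* b)) := (con 1 :+ r) :+ (con 2 :+ r) :* b) refl
          where open +-*-Solver

  free-factorization : ∀ s S lo hi → ∣ S ∣ ≤ s → (∀ q → lo ≤ q → q < hi → S (lab q) ≡ true) → NoForced lo hi →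
    Factorization lo hi (freeBound m s)
  free-factorization s S lo hi ∣S∣≤s inS noForced with lo ℕP.<? hi
  ... | no ¬lo<hi = trivial (ℕP.≮⇒≥ ¬lo<hi)
  free-factorization zero S lo hi ∣S∣≤0 inS noForced | yes lo<hi =
    ⊥-elim (ℕP.<-irrefl refl (ℕP.<-≤-trans (count-pos (λ x → S x BP.≟ true) (lab lo) (inS lo ℕP.≤-refl lo<hi)) ∣S∣≤0))
  free-factorization (suc s) S lo hi ∣S∣≤1+s inS noForced | yes lo<hi
    with Greedy.segments s S hi ∣S∣≤1+s (lab lo) (inS lo ℕP.≤-refl lo<hi) (free-factorization s) m lo (ℕP.<⇒≤ lo<hi) inS noForced
  ... | inj₂ F = F
  ... | inj₁ (c , c₀≡lo , segs , cₘ≤hi) = record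
    { marks = [] ; length≤ = z≤n ; within = λ _ ()
    ; blocks = blocks-rich lo hi rich (λ q lo≤q q<hi → [ (λ ()) , noForced q lo≤q q<hi ]′) }
    where
      rich : Rich lo hi
      rich = record
        { cut = c ; s≤cut₀ = ℕP.≤-reflexive (sym c₀≡lo) ; cut-step = λ t t<m → proj₁ (segs t t<m) ; cutₘ≤e = cₘ≤hi
        ; occurs = λ t t<m q lo≤q q<hi → proj₂ (segs t t<m) (lab q) (inS q lo≤q q<hi) }

  forcedIn? : ∀ lo hi i → Dec (lo ≤ forced i × forced i < hi)
  forcedIn? lo hi i = (lo ℕP.≤? forced i) ×-dec (forced i ℕP.<? hi)

  #forced : ℕ → ℕ → ℕ
  #forced lo hi = count (forcedIn? lo hi)

  -- Split at a forced position until none is left, then factorize greedily.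
  factorize : ∀ c lo hi → #forced lo hi ≤ c → Factorization lo hi (factorBound m NL c)
  factorize c lo hi #≤c with FP.any? (forcedIn? lo hi)
  ... | no none = weaken (freeBound≤factorBound c)
          (free-factorization NL (λ _ → true) lo hi (count≤n _) (λ _ _ _ → refl)
             (λ q lo≤q q<hi (i , fi≡q) → none (i , subst (lo ≤_) (sym fi≡q) lo≤q , subst (_< hi) (sym fi≡q) q<hi)))
    where
      freeBound≤factorBound : ∀ c → freeBound m NL ≤ factorBound m NL c
      freeBound≤factorBound zero    = ℕP.≤-refl
      freeBound≤factorBound (suc c) = ℕP.≤-trans (freeBound≤factorBound c) (ℕP.m≤m+n _ _)
  factorize zero lo hi #≤0 | yes (i , inside) =
    ⊥-elim (ℕP.<-irrefl refl (ℕP.<-≤-trans (count-pos (forcedIn? lo hi) i inside) #≤0))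
  factorize (suc c) lo hi #≤1+c | yes (i , lo≤f , f<hi) =
    join [] (λ ()) (inj₂ (i , refl)) lo≤f f<hi (factorize c lo (forced i) #left) (factorize c (suc (forced i)) hi #right)
    where
      #left : #forced lo (forced i) ≤ c
      #left = ℕP.≤-pred (ℕP.<-≤-trans
        (count-mono-< (forcedIn? lo (forced i)) (forcedIn? lo hi) (Product.map₂ (λ q<f → ℕP.<-trans q<f f<hi))
                      i (λ (_ , f<f) → ℕP.<-irrefl refl f<f) (lo≤f , f<hi))
        #≤1+c)
      #right : #forced (suc (forced i)) hi ≤ c
      #right = ℕP.≤-pred (ℕP.<-≤-trans
        (count-mono-< (forcedIn? (suc (forced i)) hi) (forcedIn? lo hi)
                      (Product.map₁ (λ f<q → ℕP.≤-trans lo≤f (ℕP.<⇒≤ f<q)))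
                      i (λ (f<f , _) → ℕP.<-irrefl refl f<f) (lo≤f , f<hi))
        #≤1+c)

Key : Set
Key = ℕ × ℕ × ℕ

_<ᴷ_ : Rel Key 0ℓ
_<ᴷ_ = ×-Lex _≡_ _<_ (×-Lex _≡_ _<_ _<_)

private
  ≋⇒≡ : ∀ {x y : Key} → Pointwise _≡_ (Pointwise _≡_ _≡_) x y → x ≡ y
  ≋⇒≡ (refl , refl , refl) = refl

  ≡⇒≋ : ∀ {x y : Key} → x ≡ y → Pointwise _≡_ (Pointwise _≡_ _≡_) x y
  ≡⇒≋ refl = refl , refl , refl

<ᴷ-cmp : Trichotomous _≡_ _<ᴷ_
<ᴷ-cmp x y with ×-compare sym ℕP.<-cmp (×-compare sym ℕP.<-cmp ℕP.<-cmp) x y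
... | tri< x<y x≉y x≯y = tri< x<y (x≉y ∘ ≡⇒≋) x≯y
... | tri≈ x≮y x≈y x≯y = tri≈ x≮y (≋⇒≡ x≈y) x≯y
... | tri> x≮y x≉y x>y = tri> x≮y (x≉y ∘ ≡⇒≋) x>y

<ᴷ-irrefl : Irreflexive _≡_ _<ᴷ_
<ᴷ-irrefl = ×-irreflexive {_≈₁_ = _≡_} {_<₁_ = _<_} {_≈₂_ = Pointwise _≡_ _≡_} {_<₂_ = _<₂_} ℕP.<-irrefl
              (×-irreflexive {_≈₁_ = _≡_} {_<₁_ = _<_} {_≈₂_ = _≡_} {_<₂_ = _<_} ℕP.<-irrefl ℕP.<-irrefl) ∘ ≡⇒≋
  where _<₂_ = ×-Lex _≡_ _<_ _<_

<ᴷ-asym : Asymmetric _<ᴷ_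
<ᴷ-asym = ×-asymmetric {_≈₁_ = _≡_} {_<₁_ = _<_} {_<₂_ = ×-Lex _≡_ _<_ _<_} sym ℕP.<-resp₂-≡ ℕP.<-asym
            (×-asymmetric {_≈₁_ = _≡_} {_<₁_ = _<_} {_<₂_ = _<_} sym ℕP.<-resp₂-≡ ℕP.<-asym ℕP.<-asym)

<ᴷ-trans : Transitive _<ᴷ_
<ᴷ-trans = ×-transitive {_≈₁_ = _≡_} {_<₁_ = _<_} {_<₂_ = ×-Lex _≡_ _<_ _<_} isEquivalence ℕP.<-resp₂-≡ ℕP.<-trans
             (×-transitive {_≈₁_ = _≡_} {_<₁_ = _<_} {_<₂_ = _<_} isEquivalence ℕP.<-resp₂-≡ ℕP.<-trans ℕP.<-trans)

_<ᴷ?_ : Decidable _<ᴷ_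
_<ᴷ?_ = ×-decidable {_≈₁_ = _≡_} {_<₁_ = _<_} {_<₂_ = ×-Lex _≡_ _<_ _<_} ℕP._≟_ ℕP._<?_
          (×-decidable {_≈₁_ = _≡_} {_<₁_ = _<_} {_<₂_ = _<_} ℕP._≟_ ℕP._<?_ ℕP._<?_)

_≟ᴷ_ : DecidableEquality Key
_≟ᴷ_ = ×P.≡-dec ℕP._≟_ (×P.≡-dec ℕP._≟_ ℕP._≟_)

∃-uniform : ∀ {K N} {P : Fin K → Fin N → Set} → (∀ i p → Dec (P i p)) →
  ((Y : Fin K → Fin N) → ∃ λ i → P i (Y i)) → ∃ λ i → ∀ p → P i p
∃-uniform {K} {N} {P} P? choice with FP.any? (λ i → FP.all? (P? i))
... | yes uniform = uniform
... | no ¬uniform = ⊥-elim (proj₂ (counterexample i) Pi)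
  where
    counterexample : ∀ i → ∃ λ p → ¬ P i p
    counterexample i = FP.¬∀⟶∃¬ N (P i) (P? i) (λ ∀p → ¬uniform (i , ∀p))
    i = proj₁ (choice (proj₁ ∘ counterexample))
    Pi = proj₂ (choice (proj₁ ∘ counterexample))

module WithExistentials {k n m} (ψ : QF k (Fin (suc n) ⊎ Fin m)) {L : Language k} (mon : Monotone L)
    (def : Defines (∃∀ (suc n) m ψ) L) where

  NL : ℕ
  NL = size (letterCodes k)

  letterOf : Fin NL → Letter k
  letterOf = Vec.lookup ∘ enum (letterCodes k)

  indexOf : Letter k → Fin NL
  indexOf = index (letterCodes k) ∘ Vec.tabulate

  letterOf-indexOf : ∀ ℓ a → letterOf (indexOf ℓ) a ≡ ℓ a
  letterOf-indexOf ℓ a =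
    trans (cong (λ v → Vec.lookup v a) (enum-index (letterCodes k) (Vec.tabulate ℓ))) (VP.lookup∘tabulate ℓ a)

  R′ R : ℕ
  R′ = factorBound m NL (suc n)
  R  = suc n + R′

  existential : Fin (suc n) → Fin R
  existential i = i F.↑ˡ R′

  Var : Set
  Var = Fin (suc n) ⊎ Fin m

  Certificate : Set
  Certificate = Vec (Fin R) R × Vec (Fin NL) R × Vec (Vec Bool NL) (suc R)

  opaque
    certificates : Enumeration Certificate
    certificates = ×-enumeration (Vec-enumeration (Fin-enumeration R) R)
      (×-enumeration (Vec-enumeration (Fin-enumeration NL) R) (Vec-enumeration (Vec-enumeration Bool-enumeration NL) (suc R)))

  markRank : Certificate → Fin R → Fin R
  markRank c = Vec.lookup (proj₁ c)

  markLetter : Certificate → Fin R → Fin NL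
  markLetter c = Vec.lookup (proj₁ (proj₂ c))

  -- Level l lies above the marks of rank < l and below the others.
  levelLetters : Certificate → Fin (suc R) → Fin NL → Bool
  levelLetters c l = Vec.lookup (Vec.lookup (proj₂ (proj₂ c)) l)

  -- A mark, or the t-th copy of letter b on level l.
  AbstractPos : Set
  AbstractPos = Fin R ⊎ Fin (suc R) × Fin (suc m) × Fin NL

  abstractPositions : Enumeration AbstractPos
  abstractPositions = ⊎-enumeration (Fin-enumeration R)
    (×-enumeration (Fin-enumeration (suc R)) (×-enumeration (Fin-enumeration (suc m)) (Fin-enumeration NL)))

  marksBelow : Certificate → ℕ → ℕ
  marksBelow c = Rank.rank ℕP._<?_ (toℕ ∘ markRank c)

  -- A level shares its height with the marks right above it and precedes them, since the
  -- copies are numbered below suc m; levels with the same marks below get the same height.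
  key : Certificate → AbstractPos → Key
  key c (inj₁ i)           = marksBelow c (toℕ (markRank c i)) , suc m , 0
  key c (inj₂ (l , t , b)) = marksBelow c (toℕ l) , toℕ t , toℕ b

  abstractLabel : Certificate → AbstractPos → Letter k
  abstractLabel c (inj₁ i)           = letterOf (markLetter c i)
  abstractLabel c (inj₂ (_ , _ , b)) = letterOf b

  Allowed : Certificate → AbstractPos → Set
  Allowed c (inj₁ _)           = ⊤
  Allowed c (inj₂ (l , _ , b)) = levelLetters c l b ≡ true

  Allowed? : ∀ c a → Dec (Allowed c a)
  Allowed? c (inj₁ _)           = yes tt
  Allowed? c (inj₂ (l , _ , b)) = levelLetters c l b BP.≟ true

  place : (Fin m → AbstractPos) → Var → AbstractPos
  place α = [ inj₁ ∘ existential , α ]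

  abstractModel : Certificate → (Fin m → AbstractPos) → Structure k Var
  abstractModel c α = induced _<ᴷ_ (key c ∘ place α) (abstractLabel c ∘ place α)

  Consistent : Certificate → Set
  Consistent c = ∀ i j → markRank c i ≡ markRank c j → markLetter c i ≡ markLetter c j

  Good : Certificate → Set
  Good c = Consistent c × ∀ α → (∀ j → Allowed c (α j)) → abstractModel c α ⊩ ψ

  opaque
    Good? : ∀ c → Dec (Good c)
    Good? c = FP.all? (λ i → FP.all? (λ j → (markRank c i FP.≟ markRank c j) →-dec (markLetter c i FP.≟ markLetter c j)))
      ×-dec ∀-dec abstractPositions m
              (λ α → FP.all? (λ j → Allowed? c (α j)) →-dec induced-dec _<ᴷ?_ _≟ᴷ_ _ _ ψ)
              (λ {α} {β} α≗β sat allowed → Equivalence.to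
                 (Embedding.induced-⇔ <ᴷ-cmp <ᴷ-irrefl <ᴷ-asym
                    (λ {x} {y} → subst₂ _<ᴷ_ (key≗ α≗β x) (key≗ α≗β y))
                    (λ {x} {y} e → trans (sym (key≗ α≗β x)) (trans e (key≗ α≗β y)))
                    (λ { (inj₁ _) a → refl ; (inj₂ j) a → cong (λ p → abstractLabel c p a) (α≗β j) }) ψ)
                 (sat (λ j → subst (Allowed c) (sym (α≗β j)) (allowed j))))
      where
        key≗ : ∀ {α β} → (∀ j → α j ≡ β j) → ∀ x → key c (place α x) ≡ key c (place β x)
        key≗ α≗β (inj₁ _) = refl
        key≗ α≗β (inj₂ j) = cong (key c) (α≗β j)

  module _ {V : Set} (c : Certificate) (x : Fin R → V) (y : V) where

    levelFormula : Fin (suc R) → QF k V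
    levelFormula l = and (All y (λ i → toℕ (markRank c i) ℕP.<? toℕ l) (λ i → lt (x i) y))
                         (All y (λ i → ¬? (toℕ (markRank c i) ℕP.<? toℕ l)) (λ i → lt y (x i)))

    levelLettersFormula : Fin (suc R) → QF k V
    levelLettersFormula l = Any y (λ b → levelLetters c l b BP.≟ true) (λ b → atLeast y (letterOf b) y)

    coveredFormula : QF k V
    coveredFormula = or (⋁ y (λ j → eq y (x j))) (⋁ y (λ l → and (levelFormula l) (levelLettersFormula l)))

    markLettersFormula : QF k V
    markLettersFormula = ⋀ y (λ i → atLeast y (letterOf (markLetter c i)) (x i))

    certFormula : QF k V
    certFormula = and (orderPattern y x (markRank c)) (and markLettersFormula coveredFormula)

    certFormula-negFree : NegFree certFormula
    certFormula-negFree =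
        orderPattern-negFree y x (markRank c)
      , ⋀-negFree y _ (λ i → atLeast-negFree y (letterOf (markLetter c i)) (x i))
      , ⋁-negFree y (λ j → eq y (x j)) (λ _ → _)
      , ⋁-negFree y (λ l → and (levelFormula l) (levelLettersFormula l))
          (λ l → ( All-negFree y (λ i → toℕ (markRank c i) ℕP.<? toℕ l) (λ i → lt (x i) y) _
                 , All-negFree y (λ i → ¬? (toℕ (markRank c i) ℕP.<? toℕ l)) (λ i → lt y (x i)) _ )
               , Any-negFree y (λ b → levelLetters c l b BP.≟ true) (λ b → atLeast y (letterOf b) y)
                   (λ b → atLeast-negFree y (letterOf b) y))

  module Shape (c : Certificate) {N} (label : Fin N → Letter k) (X : Fin R → Fin N) where

    AtLevel : Fin (suc R) → Fin N → Set
    AtLevel l p = (∀ i → toℕ (markRank c i) < toℕ l → X i <ᶠ p) × (∀ i → ¬ toℕ (markRank c i) < toℕ l → p <ᶠ X i)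

    Covered : Fin N → Set
    Covered p = (∃ λ j → p ≡ X j) ⊎ ∃ λ l → AtLevel l p × ∃ λ b → levelLetters c l b ≡ true × letterOf b ⊆ᴬ label p

    MarksOrdered : Set
    MarksOrdered = (∀ i j → markRank c i <ᶠ markRank c j → X i <ᶠ X j) × (∀ i j → markRank c i ≡ markRank c j → X i ≡ X j)

    MarksLettered : Set
    MarksLettered = ∀ i → letterOf (markLetter c i) ⊆ᴬ label (X i)

    Describes : Fin N → Set
    Describes p = MarksOrdered × MarksLettered × Covered p

  certFormula-⇔ : ∀ {V N} c (label : Fin N → Letter k) (κ : V → Fin N) (x : Fin R → V) (y : V) →
    induced _<ᶠ_ κ (label ∘ κ) ⊩ certFormula c x y ⇔ Shape.Describes c label (κ ∘ x) (κ y)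
  certFormula-⇔ c label κ x y = orderPattern-⇔ x (markRank c) ×-⇔ (lettered-⇔ ×-⇔ covered-⇔)
    where
      T = induced _<ᶠ_ κ (label ∘ κ)
      open Connectives {T = T} {v = y} refl (FP.<-irrefl refl)
      open Shape c label (κ ∘ x)
      lettered-⇔ : T ⊩ markLettersFormula c x y ⇔ MarksLettered
      lettered-⇔ = mk⇔
        (λ h i → Equivalence.to (atLeast-⇔ (markℓ i) (x i)) (Equivalence.to (⋀-⇔ atLeastᵢ) h i))
        (λ h → Equivalence.from (⋀-⇔ atLeastᵢ) (λ i → Equivalence.from (atLeast-⇔ (markℓ i) (x i)) (h i)))
        where
          markℓ = λ i → letterOf (markLetter c i)
          atLeastᵢ = λ i → atLeast y (markℓ i) (x i)
      level-⇔ : ∀ l → T ⊩ levelFormula c x y l ⇔ AtLevel l (κ y)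
      level-⇔ l = All-⇔ (λ i → toℕ (markRank c i) ℕP.<? toℕ l) (λ i → lt (x i) y)
              ×-⇔ All-⇔ (λ i → ¬? (toℕ (markRank c i) ℕP.<? toℕ l)) (λ i → lt y (x i))
      letters-⇔ : ∀ l → T ⊩ levelLettersFormula c x y l ⇔ ∃ λ b → levelLetters c l b ≡ true × letterOf b ⊆ᴬ label (κ y)
      letters-⇔ l = mk⇔
        (λ h → let (b , allowed , h′) = Equivalence.to (Any-⇔ allowed? atLeastb) h in
               b , allowed , Equivalence.to (atLeast-⇔ (letterOf b) y) h′)
        (λ (b , allowed , h) → Equivalence.from (Any-⇔ allowed? atLeastb)
                                 (b , allowed , Equivalence.from (atLeast-⇔ (letterOf b) y) h))
        where
          allowed? = λ b → levelLetters c l b BP.≟ true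
          atLeastb = λ b → atLeast y (letterOf b) y
      covered-⇔ : T ⊩ coveredFormula c x y ⇔ Covered (κ y)
      covered-⇔ = ⋁-⇔ (λ j → eq y (x j)) ⊎-⇔ mk⇔
        (λ h → let (l , h′) = Equivalence.to (⋁-⇔ levelled) h in l , Equivalence.to (level-⇔ l ×-⇔ letters-⇔ l) h′)
        (λ (l , h) → Equivalence.from (⋁-⇔ levelled) (l , Equivalence.from (level-⇔ l ×-⇔ letters-⇔ l) h))
        where levelled = λ l → and (levelFormula c x y l) (levelLettersFormula c x y l)

  describes? : ∀ c {N} (label : Fin N → Letter k) (X : Fin R → Fin N) p → Dec (Shape.Describes c label X p)
  describes? c label X p = Dec.map (certFormula-⇔ c label [ X , (λ (_ : ⊤) → p) ] inj₁ (inj₂ tt))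
    (induced-dec FP._<?_ FP._≟_ _ _ (certFormula c inj₁ (inj₂ tt)))

  K : ℕ
  K = size certificates

  -- The universal variable y i serves certificate number i.
  ψ⁺ : QF k (Fin R ⊎ Fin K)
  ψ⁺ = Any (inj₁ zero) (Good? ∘ enum certificates) (λ i → certFormula (enum certificates i) inj₁ (inj₂ i))

  ψ⁺-negFree : NegFree ψ⁺
  ψ⁺-negFree = Any-negFree (inj₁ zero) (Good? ∘ enum certificates) (λ i → certFormula (enum certificates i) inj₁ (inj₂ i))
    (λ i → certFormula-negFree (enum certificates i) inj₁ (inj₂ i))

  ψ⁺-⇔ : ∀ (w : Word k) X Y → positions w [ X , Y ] ⊩ ψ⁺ ⇔
    ∃ λ i → Good (enum certificates i) × Shape.Describes (enum certificates i) (lookup w) X (Y i)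
  ψ⁺-⇔ w X Y = mk⇔
    (λ h → let (i , good , h′) = Equivalence.to (Any-⇔ good? formula) h in
           i , good , Equivalence.to (certFormula-⇔ (enum certificates i) (lookup w) [ X , Y ] inj₁ (inj₂ i)) h′)
    (λ (i , good , h) → Equivalence.from (Any-⇔ good? formula)
           (i , good , Equivalence.from (certFormula-⇔ (enum certificates i) (lookup w) [ X , Y ] inj₁ (inj₂ i)) h))
    where
      open Connectives {T = positions w [ X , Y ]} {v = inj₁ zero} refl (FP.<-irrefl refl)
      good? = Good? ∘ enum certificates
      formula = λ i → certFormula (enum certificates i) inj₁ (inj₂ i)

  module Soundness (w : Word k) (X : Fin R → Pos w) (sat : ∀ Y → positions w [ X , Y ] ⊩ ψ⁺) where

    opaque
      uniform : ∃ λ i → ∀ p → Good (enum certificates i) × Shape.Describes (enum certificates i) (lookup w) X p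
      uniform = ∃-uniform (λ i p → Good? (enum certificates i) ×-dec describes? (enum certificates i) (lookup w) X p)
                          (λ Y → Equivalence.to (ψ⁺-⇔ w X Y) (sat Y))

    c : Certificate
    c = enum certificates (proj₁ uniform)

    open Shape c (lookup w) X
    open Rank ℕP._<?_ using (rank-mono; rank-<)

    -- All but the last component are independent of the position; X zero is just some position.
    good : Good c
    good = proj₁ (proj₂ uniform (X zero))

    ordered : MarksOrdered
    ordered = proj₁ (proj₂ (proj₂ uniform (X zero)))

    lettered : MarksLettered
    lettered = proj₁ (proj₂ (proj₂ (proj₂ uniform (X zero))))

    covered : ∀ q → Covered q
    covered q = proj₂ (proj₂ (proj₂ (proj₂ uniform q)))

    module Marks = Embedding FP.<-cmp FP.<-irrefl FP.<-asym {ρ = markRank c} {κ = X} (proj₁ ordered _ _) (proj₂ ordered _ _)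

    not-mark : ∀ {l q j} → AtLevel l q → q ≢ X j
    not-mark {l} {q} {j} (below , above) refl with toℕ (markRank c j) ℕP.<? toℕ l
    ... | yes r<l = FP.<-irrefl refl (below j r<l)
    ... | no ¬r<l = FP.<-irrefl refl (above j ¬r<l)

    below-level : ∀ {l q j} → AtLevel l q → X j <ᶠ q → toℕ (markRank c j) < toℕ l
    below-level {l} {q} {j} (_ , above) Xj<q with toℕ (markRank c j) ℕP.<? toℕ l
    ... | yes r<l = r<l
    ... | no ¬r<l = ⊥-elim (FP.<-asym Xj<q (above j ¬r<l))

    coveredLabel : ∀ q → Covered q → Letter k
    coveredLabel q (inj₁ (j , _))         = letterOf (markLetter c j)
    coveredLabel q (inj₂ (_ , _ , b , _)) = letterOf b

    lower : Pos w → Letter k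
    lower q = coveredLabel q (covered q)

    lower-⊆ : ∀ q (d : Covered q) → coveredLabel q d ⊆ᴬ lookup w q
    lower-⊆ q (inj₁ (j , refl))            = lettered j
    lower-⊆ q (inj₂ (_ , _ , _ , _ , b⊆q)) = b⊆q

    u : Word k
    u = relabel w lower

    module Tuple (η : Fin m → Pos w) where
      open Rank (FP._<?_ {length w} {length w}) using (rank) renaming (rank-< to rank-<ᶠ)

      -- Entries of η on the same level are told apart by their rank among η.
      copy : Pos w → Fin (suc m)
      copy q = fromℕ< (s≤s (count≤n (λ j → η j FP.<? q)))

      abstractOf : ∀ q → Covered q → AbstractPos
      abstractOf q (inj₁ (j , _))         = inj₁ j
      abstractOf q (inj₂ (l , _ , b , _)) = inj₂ (l , copy q , b)

      α : Fin m → AbstractPos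
      α j = abstractOf (η j) (covered (η j))

      allowed : ∀ j → Allowed c (α j)
      allowed j with covered (η j)
      ... | inj₁ _                    = tt
      ... | inj₂ (_ , _ , _ , ok , _) = ok

      ρ : Var → Pos w
      ρ = [ X ∘ existential , η ]

      Represents : Pos w → AbstractPos → Set
      Represents q (inj₁ j)           = q ≡ X j
      Represents q (inj₂ (l , t , b)) = AtLevel l q × toℕ t ≡ rank η q × ∃ λ j → η j ≡ q

      represents : ∀ x → Represents (ρ x) (place α x)
      represents (inj₁ i) = refl
      represents (inj₂ j) with covered (η j)
      ... | inj₁ (_ , ηj≡Xj′)        = ηj≡Xj′
      ... | inj₂ (_ , atLevel , _) = atLevel , FP.toℕ-fromℕ< _ , j , refl

      key-< : ∀ {q q′} a a′ → Represents q a → Represents q′ a′ → q <ᶠ q′ → key c a <ᴷ key c a′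
      key-< (inj₁ i) (inj₁ j) refl refl Xi<Xj = inj₁ (rank-< ℕP.<-trans (ℕP.<-irrefl refl) _ i (Marks.<-refl Xi<Xj))
      key-< (inj₁ i) (inj₂ (l , _)) refl (atLevel , _) Xi<q =
        inj₁ (rank-< ℕP.<-trans (ℕP.<-irrefl refl) _ i (below-level atLevel Xi<q))
      key-< (inj₂ (l , t , _)) (inj₁ j) (atLevel , _) refl q<Xj
        with ℕP.m≤n⇒m<n∨m≡n (rank-mono _ (λ {j′} r<l → Marks.<-refl (FP.<-trans (proj₁ atLevel j′ r<l) q<Xj)))
      ... | inj₁ lower-height = inj₁ lower-height
      ... | inj₂ same-height  = inj₂ (same-height , inj₁ (FP.toℕ<n t))
      key-< (inj₂ (l , t , _)) (inj₂ (l′ , t′ , _)) (atLevel , t≡ , j , refl) (atLevel′ , t′≡ , _) q<q′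
        with ℕP.m≤n⇒m<n∨m≡n (rank-mono _ (λ {j′} r<l → below-level atLevel′ (FP.<-trans (proj₁ atLevel j′ r<l) q<q′)))
      ... | inj₁ lower-height = inj₁ lower-height
      ... | inj₂ same-height  =
        inj₂ (same-height , inj₁ (subst₂ _<_ (sym t≡) (sym t′≡) (rank-<ᶠ FP.<-trans (FP.<-irrefl refl) η j q<q′)))

      mark-key : ∀ {i j} → X i ≡ X j → key c (inj₁ i) ≡ key c (inj₁ j)
      mark-key Xi≡Xj = cong (λ r → marksBelow c (toℕ r) , suc m , 0) (Marks.≡-refl Xi≡Xj)

      mark-key-at : ∀ {i} q → q ≡ X i → (d : Covered q) → key c (inj₁ i) ≡ key c (abstractOf q d)
      mark-key-at q q≡Xi (inj₁ (j , q≡Xj))       = mark-key (trans (sym q≡Xi) q≡Xj)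
      mark-key-at q q≡Xi (inj₂ (_ , atLevel , _)) = ⊥-elim (not-mark atLevel q≡Xi)

      key-≡ : ∀ {x y} → ρ x ≡ ρ y → key c (place α x) ≡ key c (place α y)
      key-≡ {inj₁ i} {inj₁ i′} e = mark-key e
      key-≡ {inj₁ i} {inj₂ j}  e = mark-key-at (η j) (sym e) (covered (η j))
      key-≡ {inj₂ j} {inj₁ i}  e = sym (mark-key-at (η j) e (covered (η j)))
      key-≡ {inj₂ j} {inj₂ j′} e = cong (λ q → key c (abstractOf q (covered q))) e

      labels : ∀ x a → lower (ρ x) a ≡ abstractLabel c (place α x) a
      labels (inj₁ i) a = mark-label (covered (X (existential i)))
        where
          mark-label : (d : Covered (X (existential i))) → coveredLabel _ d a ≡ letterOf (markLetter c (existential i)) a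
          mark-label (inj₁ (j , Xi≡Xj))       =
            cong (λ b → letterOf b a) (proj₁ good j (existential i) (Marks.≡-refl (sym Xi≡Xj)))
          mark-label (inj₂ (_ , atLevel , _)) = ⊥-elim (not-mark atLevel refl)
      labels (inj₂ j) a = same-label (covered (η j))
        where
          same-label : (d : Covered (η j)) → coveredLabel (η j) d a ≡ abstractLabel c (abstractOf (η j) d) a
          same-label (inj₁ _) = refl
          same-label (inj₂ _) = refl

      ψ-holds : induced _<ᶠ_ ρ (lower ∘ ρ) ⊩ ψ
      ψ-holds = Equivalence.from
        (Embedding.induced-⇔ FP.<-cmp <ᴷ-irrefl <ᴷ-asym
          (λ {x} {y} → key-< (place α x) (place α y) (represents x) (represents y)) (λ {x} {y} → key-≡ {x} {y}) labels ψ)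
        (proj₂ good α allowed)

    toRelabel : Pos w → Pos u
    toRelabel = cast (sym (length-relabel w lower))

    u⊨ψ : u ⊨ ∃∀ (suc n) m ψ
    u⊨ψ = toRelabel ∘ X ∘ existential , λ ηu →
      let η = cast (length-relabel w lower) ∘ ηu in
      Equivalence.from (evalQF⇔positions u _ ψ)
        (Equivalence.from (relabel-⇔ w lower (Tuple.ρ η) [ toRelabel ∘ X ∘ existential , ηu ]
                            (λ { (inj₁ i) → FP.toℕ-cast _ _ ; (inj₂ j) → sym (FP.toℕ-cast _ (ηu j)) }) ψ)
          (Tuple.ψ-holds η))

    inL : L w
    inL = mon u w (Equivalence.from (def u) u⊨ψ) (relabel-≤ᵂ w lower (λ q → lower-⊆ q (covered q)))

  module Completeness (w : Word k) (Lw : L w) where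

    opaque
      w⊨ψ : w ⊨ ∃∀ (suc n) m ψ
      w⊨ψ = Equivalence.to (def w) Lw

    N : ℕ
    N = length w

    ξ : Fin (suc n) → Pos w
    ξ = proj₁ w⊨ψ

    -- Letter codes of w, extended arbitrarily beyond its end.
    opaque
      lab : ℕ → Fin NL
      lab q with q ℕP.<? N
      ... | yes q<N = indexOf (lookup w (fromℕ< q<N))
      ... | no _    = indexOf (lookup w (ξ zero))

      lab-pos : ∀ (p : Pos w) → lab (toℕ p) ≡ indexOf (lookup w p)
      lab-pos p with toℕ p ℕP.<? N
      ... | yes p<N = cong (indexOf ∘ lookup w) (FP.fromℕ<-toℕ p p<N)
      ... | no p≮N  = ⊥-elim (p≮N (FP.toℕ<n p))

    open Factorization m lab (toℕ ∘ ξ)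
    open Factorization.Factorization

    opaque
      F : Factorization 0 N R′
      F = factorize (suc n) 0 N (count≤n (forcedIn? 0 N))

    -- The marks of the factorization, padded with the forced mark ξ zero.
    opaque
      extra : Fin R′ → Pos w
      extra j with toℕ j ℕP.<? length (marks F)
      ... | yes j<len = fromℕ< (proj₂ (within F _ (∈.∈-lookup (fromℕ< j<len))))
      ... | no _      = ξ zero

      extra-marked : ∀ j → Marked (marks F) (toℕ (extra j))
      extra-marked j with toℕ j ℕP.<? length (marks F)
      ... | yes j<len = inj₁ (subst (_∈ marks F) (sym (FP.toℕ-fromℕ< _)) (∈.∈-lookup (fromℕ< j<len)))
      ... | no _      = inj₂ (zero , refl)

      extra-onto : ∀ {q} → q ∈ marks F → ∃ λ j → toℕ (extra j) ≡ q
      extra-onto {q} q∈ = j , toℕ-extra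
        where
          j : Fin R′
          j = fromℕ< (ℕP.<-≤-trans (FP.toℕ<n (Any.index q∈)) (length≤ F))
          toℕ-extra : toℕ (extra j) ≡ q
          toℕ-extra with toℕ j ℕP.<? length (marks F)
          ... | yes j<len = trans (FP.toℕ-fromℕ< _)
                              (trans (cong (lookup (marks F)) (FP.toℕ-injective (trans (FP.toℕ-fromℕ< j<len) (FP.toℕ-fromℕ< _))))
                                     (sym (AnyP.lookup-index q∈)))
          ... | no j≮len  = ⊥-elim (j≮len (subst (_< length (marks F)) (sym (FP.toℕ-fromℕ< _)) (FP.toℕ<n (Any.index q∈))))

    opaque
      X : Fin R → Pos w
      X = [ ξ , extra ] ∘ F.splitAt (suc n)

      X-existential : ∀ i → X (existential i) ≡ ξ i
      X-existential i = cong [ ξ , extra ] (FP.splitAt-↑ˡ (suc n) i R′)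

      X-extra : ∀ j → X (suc n F.↑ʳ j) ≡ extra j
      X-extra j = cong [ ξ , extra ] (FP.splitAt-↑ʳ (suc n) R′ j)

      X-cases : ∀ j → (∃ λ i → X j ≡ ξ i) ⊎ (∃ λ j′ → X j ≡ extra j′)
      X-cases j with F.splitAt (suc n) j
      ... | inj₁ i  = inj₁ (i , refl)
      ... | inj₂ j′ = inj₂ (j′ , refl)

    IsMark : Pos w → Set
    IsMark p = ∃ λ j → X j ≡ p

    isMark? : ∀ p → Dec (IsMark p)
    isMark? p = FP.any? (λ j → X j FP.≟ p)

    mark⇒marked : ∀ {p} → IsMark p → Marked (marks F) (toℕ p)
    mark⇒marked (j , refl) with X-cases j
    ... | inj₁ (i , Xj≡ξi)    = inj₂ (i , cong toℕ (sym Xj≡ξi))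
    ... | inj₂ (j′ , Xj≡extra) = subst (Marked (marks F)) (cong toℕ (sym Xj≡extra)) (extra-marked j′)

    marked⇒mark : ∀ {p} → Marked (marks F) (toℕ p) → IsMark p
    marked⇒mark (inj₁ p∈) = let (j , e) = extra-onto p∈ in suc n F.↑ʳ j , trans (X-extra j) (FP.toℕ-injective e)
    marked⇒mark (inj₂ (i , e)) = existential i , trans (X-existential i) (FP.toℕ-injective e)

    open Rank (FP._<?_ {N} {N}) using (rank; rank-<; rank-mono)
    open OrderType FP._<?_ FP.<-cmp FP.<-trans FP.<-irrefl X
      using (orderType; toℕ-orderType; orderType-≡; orderType-<⁻¹; orderType-≡⁻¹)

    opaque
      level : Pos w → Fin (suc R)
      level p = fromℕ< (s≤s (count≤n (λ j → X j FP.<? p)))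

      toℕ-level : ∀ p → toℕ (level p) ≡ rank X p
      toℕ-level p = FP.toℕ-fromℕ< _

    below⇒ : ∀ {j p} → X j <ᶠ p → toℕ (orderType j) < toℕ (level p)
    below⇒ {j} {p} Xj<p =
      subst₂ _<_ (sym (toℕ-orderType j)) (sym (toℕ-level p)) (rank-< FP.<-trans (FP.<-irrefl refl) X j Xj<p)

    below⇐ : ∀ {j p} → toℕ (orderType j) < toℕ (level p) → X j <ᶠ p
    below⇐ {j} {p} rj<lp with X j FP.<? p
    ... | yes Xj<p = Xj<p
    ... | no Xj≮p  = ⊥-elim (ℕP.<⇒≱ (subst₂ _<_ (toℕ-orderType j) (toℕ-level p) rj<lp)
                                     (rank-mono X (λ Xi<p → ℕP.<-≤-trans Xi<p (ℕP.≮⇒≥ Xj≮p))))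

    level-< : ∀ {p q} → toℕ (level p) < toℕ (level q) → p <ᶠ q
    level-< {p} {q} lp<lq with p FP.<? q
    ... | yes p<q = p<q
    ... | no p≮q  = ⊥-elim (ℕP.<⇒≱ (subst₂ _<_ (toℕ-level p) (toℕ-level q) lp<lq)
                                    (rank-mono X (λ Xi<q → ℕP.<-≤-trans Xi<q (ℕP.≮⇒≥ p≮q))))

    same-level : ∀ {p q j} → level p ≡ level q → X j <ᶠ p → X j <ᶠ q
    same-level {p} {q} {j} lp≡lq Xj<p = below⇐ {j} {q} (subst (λ l → toℕ (orderType j) < toℕ l) lp≡lq (below⇒ {j} {p} Xj<p))

    OccursAtLevel : Fin (suc R) → Fin NL → Set
    OccursAtLevel l b = ∃ λ p → ¬ IsMark p × level p ≡ l × indexOf (lookup w p) ≡ b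

    occursAtLevel? : ∀ l b → Dec (OccursAtLevel l b)
    occursAtLevel? l b = FP.any? (λ p → ¬? (isMark? p) ×-dec ((level p FP.≟ l) ×-dec (indexOf (lookup w p) FP.≟ b)))

    opaque
      c₀ : Certificate
      c₀ = Vec.tabulate orderType , Vec.tabulate (indexOf ∘ lookup w ∘ X)
         , Vec.tabulate (Vec.tabulate ∘ (does ∘_) ∘ occursAtLevel?)

      markRank-c₀ : ∀ i → markRank c₀ i ≡ orderType i
      markRank-c₀ = VP.lookup∘tabulate orderType

      markLetter-c₀ : ∀ i → markLetter c₀ i ≡ indexOf (lookup w (X i))
      markLetter-c₀ = VP.lookup∘tabulate (indexOf ∘ lookup w ∘ X)

      levelLetters-c₀ : ∀ l b → levelLetters c₀ l b ≡ does (occursAtLevel? l b)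
      levelLetters-c₀ l b = trans
        (cong (λ v → Vec.lookup v b) (VP.lookup∘tabulate (Vec.tabulate ∘ (does ∘_) ∘ occursAtLevel?) l))
        (VP.lookup∘tabulate (does ∘ occursAtLevel? l) b)

    allowed⇒occurs : ∀ {l b} → levelLetters c₀ l b ≡ true → OccursAtLevel l b
    allowed⇒occurs {l} {b} allowed = witness (occursAtLevel? l b) (trans (sym (levelLetters-c₀ l b)) allowed)
      where
        witness : ∀ {P : Set} (P? : Dec P) → does P? ≡ true → P
        witness (yes p) _ = p

    rank₀<level⇔ : ∀ {j p} → toℕ (markRank c₀ j) < toℕ (level p) ⇔ X j <ᶠ p
    rank₀<level⇔ {j} {p} = mk⇔ (below⇐ {j} {p} ∘ subst (λ r → toℕ r < toℕ (level p)) (markRank-c₀ j))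
                                (subst (λ r → toℕ r < toℕ (level p)) (sym (markRank-c₀ j)) ∘ below⇒ {j} {p})

    marksBelow-level : ∀ p → marksBelow c₀ (toℕ (level p)) ≡ toℕ (level p)
    marksBelow-level p = trans
      (count-cong (λ j → toℕ (markRank c₀ j) ℕP.<? toℕ (level p)) (λ j → X j FP.<? p)
                  (Equivalence.to rank₀<level⇔) (Equivalence.from rank₀<level⇔))
      (sym (toℕ-level p))

    rank₀≡level : ∀ i → toℕ (markRank c₀ i) ≡ toℕ (level (X i))
    rank₀≡level i = trans (cong toℕ (markRank-c₀ i)) (trans (toℕ-orderType i) (sym (toℕ-level (X i))))

    marksBelow-mark : ∀ i → marksBelow c₀ (toℕ (markRank c₀ i)) ≡ toℕ (markRank c₀ i)
    marksBelow-mark i = subst (λ v → marksBelow c₀ v ≡ v) (sym (rank₀≡level i)) (marksBelow-level (X i))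

    open Shape c₀ (lookup w) X

    ordered₀ : MarksOrdered
    ordered₀ = (λ i j r<r → orderType-<⁻¹ {i} {j} (subst₂ _<ᶠ_ (markRank-c₀ i) (markRank-c₀ j) r<r))
             , (λ i j r≡r → orderType-≡⁻¹ {i} {j} (trans (sym (markRank-c₀ i)) (trans r≡r (markRank-c₀ j))))

    letter₀ : ∀ p a → letterOf (indexOf (lookup w p)) a ≡ lookup w p a
    letter₀ p = letterOf-indexOf (lookup w p)

    lettered₀ : MarksLettered
    lettered₀ i a = subst (_≡ true) (trans (cong (λ b → letterOf b a) (markLetter-c₀ i)) (letter₀ (X i) a))

    atOwnLevel : ∀ p → ¬ IsMark p → AtLevel (level p) p
    atOwnLevel p ¬mark = (λ i → Equivalence.to (rank₀<level⇔ {i} {p})) , above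
      where
        above : ∀ i → ¬ toℕ (markRank c₀ i) < toℕ (level p) → p <ᶠ X i
        above i ¬r<l with FP.<-cmp p (X i)
        ... | tri< p<Xi _ _ = p<Xi
        ... | tri≈ _ p≡Xi _ = ⊥-elim (¬mark (i , sym p≡Xi))
        ... | tri> _ _ Xi<p = ⊥-elim (¬r<l (Equivalence.from (rank₀<level⇔ {i} {p}) Xi<p))

    covered₀ : ∀ p → Covered p
    covered₀ p with isMark? p
    ... | yes (j , Xj≡p) = inj₁ (j , sym Xj≡p)
    ... | no ¬mark = inj₂ (level p , atOwnLevel p ¬mark , indexOf (lookup w p)
                          , trans (levelLetters-c₀ _ _) (dec-true (occursAtLevel? _ _) (p , ¬mark , refl , refl))
                          , λ a → subst (_≡ true) (letter₀ p a))

    describes₀ : ∀ p → Describes p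
    describes₀ p = ordered₀ , lettered₀ , covered₀ p

    Representative : Fin (suc R) → Set
    Representative l = ∃ λ r → ¬ IsMark r × level r ≡ l

    representative? : ∀ l → Dec (Representative l)
    representative? l = FP.any? (λ r → ¬? (isMark? r) ×-dec (level r FP.≟ l))

    mark-at : ∀ {q} → q < N → Marked (marks F) q → ∃ λ j → toℕ (X j) ≡ q
    mark-at q<N q-marked = let (j , Xj≡q) = marked⇒mark (subst (Marked (marks F)) (sym (FP.toℕ-fromℕ< q<N)) q-marked) in
      j , trans (cong toℕ Xj≡q) (FP.toℕ-fromℕ< q<N)

    module BlockOf (r : Pos w) (r-free : ¬ IsMark r) where
      open Block (blocks F (toℕ r) z≤n (FP.toℕ<n r) (r-free ∘ marked⇒mark)) public
      open Rich rich

      Inside : Pos w → Set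
      Inside q = start ≤ toℕ q × toℕ q < end

      inside-free : ∀ {q} → Inside q → ¬ IsMark q
      inside-free (s≤q , q<e) = unmarked _ s≤q q<e ∘ mark⇒marked

      mark-outside : ∀ j → toℕ (X j) < start ⊎ end ≤ toℕ (X j)
      mark-outside j with toℕ (X j) ℕP.<? start | toℕ (X j) ℕP.<? end
      ... | yes Xj<s | _        = inj₁ Xj<s
      ... | no _     | no Xj≮e  = inj₂ (ℕP.≮⇒≥ Xj≮e)
      ... | no Xj≮s  | yes Xj<e = ⊥-elim (inside-free (ℕP.≮⇒≥ Xj≮s , Xj<e) (j , refl))

      inside-level : ∀ {q} → Inside q → level q ≡ level r
      inside-level {q} q-in = FP.toℕ-injective (trans (toℕ-level q)
        (trans (count-cong (λ j → X j FP.<? q) (λ j → X j FP.<? r)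
                           (λ {j} → across q-in (start≤p , p<end) {j}) (λ {j} → across (start≤p , p<end) q-in {j}))
               (sym (toℕ-level r))))
        where
          across : ∀ {q q′} → Inside q → Inside q′ → ∀ {j} → X j <ᶠ q → X j <ᶠ q′
          across (_ , q<e) (s≤q′ , _) {j} Xj<q with mark-outside j
          ... | inj₁ Xj<s = ℕP.<-≤-trans Xj<s s≤q′
          ... | inj₂ e≤Xj = ⊥-elim (ℕP.<-irrefl refl (ℕP.<-≤-trans (ℕP.<-trans Xj<q q<e) e≤Xj))

      -- The block is delimited by marks, so it contains every unmarked position on r's level.
      contains : ∀ {p} → ¬ IsMark p → level p ≡ level r → Inside p
      contains {p} p-free same = after-start left-bounded , before-end right-bounded
        where
          after-start : start ≡ 0 ⊎ (∃ λ s → start ≡ suc s × 0 ≤ s × Marked (marks F) s) → start ≤ toℕ p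
          after-start (inj₁ s≡0) = subst (_≤ toℕ p) (sym s≡0) z≤n
          after-start (inj₂ (s , s≡1+s , _ , s-marked)) with start ℕP.≤? toℕ p
          ... | yes s≤p = s≤p
          ... | no s≰p  = ⊥-elim (FP.<-asym p<Xj (same-level {j = j} (sym same) Xj<r))
            where
              s<r : s < toℕ r
              s<r = subst (_≤ toℕ r) s≡1+s start≤p
              j = proj₁ (mark-at (ℕP.<-trans s<r (FP.toℕ<n r)) s-marked)
              Xj≡s = proj₂ (mark-at (ℕP.<-trans s<r (FP.toℕ<n r)) s-marked)
              Xj<r : X j <ᶠ r
              Xj<r = subst (_< toℕ r) (sym Xj≡s) s<r
              p<Xj : p <ᶠ X j
              p<Xj = ℕP.≤∧≢⇒< (subst (toℕ p ≤_) (sym Xj≡s) (ℕP.≤-pred (subst (toℕ p <_) s≡1+s (ℕP.≰⇒> s≰p))))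
                               (λ p≡Xj → p-free (j , FP.toℕ-injective (sym p≡Xj)))
          before-end : end ≡ N ⊎ end < N × Marked (marks F) end → toℕ p < end
          before-end (inj₁ e≡N) = subst (toℕ p <_) (sym e≡N) (FP.toℕ<n p)
          before-end (inj₂ (e<N , e-marked)) with toℕ p ℕP.<? end
          ... | yes p<e = p<e
          ... | no p≮e  = ⊥-elim (FP.<-asym r<Xj (same-level {j = j} same Xj<p))
            where
              j = proj₁ (mark-at e<N e-marked)
              Xj≡e = proj₂ (mark-at e<N e-marked)
              r<Xj : r <ᶠ X j
              r<Xj = subst (toℕ r <_) (sym Xj≡e) p<end
              Xj<p : X j <ᶠ p
              Xj<p = ℕP.≤∧≢⇒< (subst (_≤ toℕ p) (sym Xj≡e) (ℕP.≮⇒≥ p≮e))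
                               (λ Xj≡p → p-free (j , FP.toℕ-injective Xj≡p))

      opaque
        toPos : ℕ → Pos w
        toPos q with q ℕP.<? N
        ... | yes q<N = fromℕ< q<N
        ... | no _    = r

        toℕ-toPos : ∀ {q} → q < N → toℕ (toPos q) ≡ q
        toℕ-toPos {q} q<N with q ℕP.<? N
        ... | yes _   = FP.toℕ-fromℕ< _
        ... | no q≮N  = ⊥-elim (q≮N q<N)

        cut≤end : ∀ {t} → t ≤ m → cut t ≤ end
        cut≤end t≤m = ℕP.≤-trans (cut-mono t≤m ℕP.≤-refl) cutₘ≤e

        occurrence : Fin NL → ℕ → Pos w
        occurrence b t with occurs? b (cut t) (cut (suc t))
        ... | yes (q , _) = toPos q
        ... | no _        = r

        occurrence-spec : ∀ {b} → OccursAtLevel (level r) b → ∀ {t} → t < m →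
          cut t ≤ toℕ (occurrence b t) × toℕ (occurrence b t) < cut (suc t) × lab (toℕ (occurrence b t)) ≡ b
        occurrence-spec {b} b-here {t} t<m with occurs? b (cut t) (cut (suc t))
        ... | yes (q , c≤q , q<c , lab-q) =
          let e = toℕ-toPos (ℕP.<-≤-trans q<c (ℕP.≤-trans (cut≤end t<m) end≤hi)) in
          subst (cut t ≤_) (sym e) c≤q , subst (_< cut (suc t)) (sym e) q<c , subst (λ q → lab q ≡ b) (sym e) lab-q
        ... | no none =
          let (p , p-free , same , p-letter) = b-here in
          ⊥-elim (none (subst (λ x → Occurs x (cut t) (cut (suc t))) (trans (lab-pos p) p-letter)
                              (let (s≤p , p<e) = contains p-free same in occurs t t<m (toℕ p) s≤p p<e)))

        occurrence-inside : ∀ {b} → OccursAtLevel (level r) b → ∀ {t} → t < m → Inside (occurrence b t)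
        occurrence-inside b-here t<m =
            ℕP.≤-trans s≤cut₀ (ℕP.≤-trans (cut-mono z≤n (ℕP.<⇒≤ t<m)) (proj₁ (occurrence-spec b-here t<m)))
          , ℕP.<-≤-trans (proj₁ (proj₂ (occurrence-spec b-here t<m))) (cut≤end t<m)

        occurrence-letter : ∀ {b} → OccursAtLevel (level r) b → ∀ {t} → t < m → indexOf (lookup w (occurrence b t)) ≡ b
        occurrence-letter b-here t<m = trans (sym (lab-pos _)) (proj₂ (proj₂ (occurrence-spec b-here t<m)))

        occurrence-< : ∀ {b b′} → OccursAtLevel (level r) b → OccursAtLevel (level r) b′ → ∀ {t t′} → t < t′ → t′ < m →
          occurrence b t <ᶠ occurrence b′ t′
        occurrence-< b-here b′-here t<t′ t′<m =
          ℕP.<-≤-trans (proj₁ (proj₂ (occurrence-spec b-here (ℕP.<-trans t<t′ t′<m))))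
            (ℕP.≤-trans (cut-mono t<t′ (ℕP.<⇒≤ t′<m)) (proj₁ (occurrence-spec b′-here t′<m)))

    has-representative : ∀ {l b} → OccursAtLevel l b → Representative l
    has-representative (p , p-free , p-at-l , _) = p , p-free , p-at-l

    at-representative : ∀ {l b r} → level r ≡ l → OccursAtLevel l b → OccursAtLevel (level r) b
    at-representative {b = b} r-at-l = subst (λ l → OccursAtLevel l b) (sym r-at-l)

    -- Occurrences on a level are taken in the block of a fixed representative of the level.
    opaque
      occurrence : Fin (suc R) → Fin NL → ℕ → Pos w
      occurrence l b t with representative? l
      ... | yes (r , r-free , _) = BlockOf.occurrence r r-free b t
      ... | no _                 = X zero

      occurrence-level : ∀ {l b} → OccursAtLevel l b → ∀ {t} → t < m → level (occurrence l b t) ≡ l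
      occurrence-level {l} b-at-l t<m with representative? l
      ... | yes (r , r-free , r-at-l) = trans
        (BlockOf.inside-level r r-free (BlockOf.occurrence-inside r r-free (at-representative {r = r} r-at-l b-at-l) t<m))
        r-at-l
      ... | no none = ⊥-elim (none (has-representative b-at-l))

      occurrence-free : ∀ {l b} → OccursAtLevel l b → ∀ {t} → t < m → ¬ IsMark (occurrence l b t)
      occurrence-free {l} b-at-l t<m with representative? l
      ... | yes (r , r-free , r-at-l) = BlockOf.inside-free r r-free
                                          (BlockOf.occurrence-inside r r-free (at-representative {r = r} r-at-l b-at-l) t<m)
      ... | no none = ⊥-elim (none (has-representative b-at-l))

      occurrence-letter : ∀ {l b} → OccursAtLevel l b → ∀ {t} → t < m → indexOf (lookup w (occurrence l b t)) ≡ b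
      occurrence-letter {l} b-at-l t<m with representative? l
      ... | yes (r , r-free , r-at-l) = BlockOf.occurrence-letter r r-free (at-representative {r = r} r-at-l b-at-l) t<m
      ... | no none = ⊥-elim (none (has-representative b-at-l))

      occurrence-< : ∀ {l b b′} → OccursAtLevel l b → OccursAtLevel l b′ → ∀ {t t′} → t < t′ → t′ < m →
        occurrence l b t <ᶠ occurrence l b′ t′
      occurrence-< {l} b-at-l b′-at-l t<t′ t′<m with representative? l
      ... | yes (r , r-free , r-at-l) = BlockOf.occurrence-< r r-free (at-representative {r = r} r-at-l b-at-l)
                                          (at-representative {r = r} r-at-l b′-at-l) t<t′ t′<m
      ... | no none = ⊥-elim (none (has-representative b-at-l))

    -- Abstract positions are realized in w: marks by X, the copies of a letter on a level
    -- by its occurrences in consecutive segments.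
    Copy : AbstractPos → Set
    Copy (inj₁ _) = ⊤
    Copy (inj₂ _) = Fin m

    realize : (a : AbstractPos) → Copy a → Pos w
    realize (inj₁ i)           _ = X i
    realize (inj₂ (l , _ , b)) t = occurrence l b (toℕ t)

    CopiesOrdered CopiesEqual : ∀ a a′ → Copy a → Copy a′ → Set
    CopiesOrdered (inj₂ _) (inj₂ _) t t′ = toℕ t < toℕ t′
    CopiesOrdered (inj₁ _) _        _ _  = ⊤
    CopiesOrdered (inj₂ _) (inj₁ _) _ _  = ⊤
    CopiesEqual (inj₂ _) (inj₂ _) t t′ = t ≡ t′
    CopiesEqual (inj₁ _) _        _ _  = ⊤
    CopiesEqual (inj₂ _) (inj₁ _) _ _  = ⊤

    copyFor : ∀ a → Fin m → Copy a
    copyFor (inj₁ _) _ = tt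
    copyFor (inj₂ _) t = t

    ordered-before-mark : ∀ a {t i} → CopiesOrdered a (inj₁ i) t tt
    ordered-before-mark (inj₁ _) = tt
    ordered-before-mark (inj₂ _) = tt

    ordered-for : ∀ a a′ {t t′} → toℕ t < toℕ t′ → CopiesOrdered a a′ (copyFor a t) (copyFor a′ t′)
    ordered-for (inj₁ _) _        _    = tt
    ordered-for (inj₂ _) (inj₁ _) _    = tt
    ordered-for (inj₂ _) (inj₂ _) t<t′ = t<t′

    equal-at-mark : ∀ a {t i} → CopiesEqual a (inj₁ i) t tt
    equal-at-mark (inj₁ _) = tt
    equal-at-mark (inj₂ _) = tt

    equal-for : ∀ a a′ {t t′} → t ≡ t′ → CopiesEqual a a′ (copyFor a t) (copyFor a′ t′)
    equal-for (inj₁ _) _        _    = tt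
    equal-for (inj₂ _) (inj₁ _) _    = tt
    equal-for (inj₂ _) (inj₂ _) t≡t′ = t≡t′

    allowed-height : ∀ {l b} → levelLetters c₀ l b ≡ true → marksBelow c₀ (toℕ l) ≡ toℕ l
    allowed-height ok = let (p , _ , p-at-l , _) = allowed⇒occurs ok in
      subst (λ l → marksBelow c₀ (toℕ l) ≡ toℕ l) p-at-l (marksBelow-level p)

    height : ∀ a t → Allowed c₀ a → proj₁ (key c₀ a) ≡ toℕ (level (realize a t))
    height (inj₁ i)           _ _  = trans (marksBelow-mark i) (rank₀≡level i)
    height (inj₂ (l , _ , b)) t ok =
      trans (allowed-height ok) (cong toℕ (sym (occurrence-level (allowed⇒occurs ok) (FP.toℕ<n t))))

    free-before-mark : ∀ {q i} → ¬ IsMark q → toℕ (level q) ≡ toℕ (level (X i)) → q <ᶠ X i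
    free-before-mark {q} {i} q-free same with FP.<-cmp q (X i)
    ... | tri< q<Xi _ _ = q<Xi
    ... | tri≈ _ q≡Xi _ = ⊥-elim (q-free (i , sym q≡Xi))
    ... | tri> _ _ Xi<q = ⊥-elim (ℕP.<-irrefl (trans (toℕ-orderType i) (trans (sym (toℕ-level (X i))) (sym same)))
                                              (below⇒ {i} {q} Xi<q))

    realize-< : ∀ a a′ t t′ → Allowed c₀ a → Allowed c₀ a′ → key c₀ a <ᴷ key c₀ a′ → CopiesOrdered a a′ t t′ →
      realize a t <ᶠ realize a′ t′
    realize-< a a′ t t′ ok ok′ (inj₁ h<h′) _ = level-< (subst₂ _<_ (height a t ok) (height a′ t′ ok′) h<h′)
    realize-< (inj₁ i) (inj₁ i′) _ _ _ _ (inj₂ (_ , inj₁ m<m)) _ = ⊥-elim (ℕP.<-irrefl refl m<m)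
    realize-< (inj₁ i) (inj₂ (_ , t₀ , _)) _ _ _ _ (inj₂ (_ , inj₁ m<t₀)) _ = ⊥-elim (ℕP.<-asym m<t₀ (FP.toℕ<n t₀))
    realize-< (inj₁ i) (inj₂ (_ , t₀ , _)) _ _ _ _ (inj₂ (_ , inj₂ (m≡t₀ , _))) _ = ⊥-elim (ℕP.<-irrefl (sym m≡t₀) (FP.toℕ<n t₀))
    realize-< (inj₂ (l , t₀ , b)) (inj₁ i) t _ ok _ (inj₂ (same , _)) _ =
      free-before-mark (occurrence-free (allowed⇒occurs ok) (FP.toℕ<n t))
        (trans (sym (height (inj₂ (l , t₀ , b)) t ok)) (trans same (height (inj₁ i) tt tt)))
    realize-< (inj₂ (l , _ , b)) (inj₂ (l′ , _ , b′)) t t′ ok ok′ (inj₂ (same , _)) t<t′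
      with FP.toℕ-injective (trans (sym (allowed-height ok)) (trans same (allowed-height ok′)))
    ... | refl = occurrence-< (allowed⇒occurs ok) (allowed⇒occurs ok′) t<t′ (FP.toℕ<n t′)

    realize-≡ : ∀ a a′ t t′ → Allowed c₀ a → Allowed c₀ a′ → key c₀ a ≡ key c₀ a′ → CopiesEqual a a′ t t′ →
      realize a t ≡ realize a′ t′
    realize-≡ (inj₁ i) (inj₁ i′) _ _ _ _ same _ = orderType-≡⁻¹ {i} {i′}
      (trans (sym (markRank-c₀ i)) (trans (FP.toℕ-injective
        (trans (sym (marksBelow-mark i)) (trans (cong proj₁ same) (marksBelow-mark i′)))) (markRank-c₀ i′)))
    realize-≡ (inj₁ i) (inj₂ (_ , t₀ , _)) _ _ _ _ same _ = ⊥-elim (ℕP.<-irrefl (cong (proj₁ ∘ proj₂) (sym same)) (FP.toℕ<n t₀))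
    realize-≡ (inj₂ (_ , t₀ , _)) (inj₁ i) _ _ _ _ same _ = ⊥-elim (ℕP.<-irrefl (cong (proj₁ ∘ proj₂) same) (FP.toℕ<n t₀))
    realize-≡ (inj₂ (l , _ , b)) (inj₂ (l′ , _ , b′)) t t′ ok ok′ same refl
      with FP.toℕ-injective (trans (sym (allowed-height ok)) (trans (cong proj₁ same) (allowed-height ok′)))
         | FP.toℕ-injective {i = b} {j = b′} (cong (proj₂ ∘ proj₂) same)
    ... | refl | refl = refl

    realize-label : ∀ a t → Allowed c₀ a → ∀ x → abstractLabel c₀ a x ≡ lookup w (realize a t) x
    realize-label (inj₁ i)           _ _  x = trans (cong (λ b → letterOf b x) (markLetter-c₀ i)) (letter₀ (X i) x)
    realize-label (inj₂ (l , _ , b)) t ok x =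
      trans (cong (λ b → letterOf b x) (sym (occurrence-letter (allowed⇒occurs ok) (FP.toℕ<n t)))) (letter₀ _ x)

    consistent₀ : Consistent c₀
    consistent₀ i j r≡r = trans (markLetter-c₀ i) (trans (cong (indexOf ∘ lookup w) Xi≡Xj) (sym (markLetter-c₀ j)))
      where Xi≡Xj = orderType-≡⁻¹ {i} {j} (trans (sym (markRank-c₀ i)) (trans r≡r (markRank-c₀ j)))

    -- Copies are numbered by the rank of their key, so that they fit into distinct segments.
    satisfies : ∀ α → (∀ j → Allowed c₀ (α j)) → abstractModel c₀ α ⊩ ψ
    satisfies α allowed = Equivalence.from
      (Embedding.induced-⇔ <ᴷ-cmp FP.<-irrefl FP.<-asym
         (λ {x} {y} h → realize-< (place α x) (place α y) (copyOf x) (copyOf y) (allowedAt x) (allowedAt y) h (ordered x y h))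
         (λ {x} {y} e → realize-≡ (place α x) (place α y) (copyOf x) (copyOf y) (allowedAt x) (allowedAt y) e (equal x y e))
         (λ x → realize-label (place α x) (copyOf x) (allowedAt x)) ψ)
      (Equivalence.to (SameIndices.induced-⇔ same labels ψ)
        (Equivalence.to (evalQF⇔positions w _ ψ) (proj₂ w⊨ψ (κ ∘ inj₂))))
      where
        open OrderType _<ᴷ?_ <ᴷ-cmp <ᴷ-trans <ᴷ-irrefl (key c₀ ∘ α)
          renaming (orderType to copy; orderType-< to copy-<; orderType-≡ to copy-≡)

        copyOf : ∀ x → Copy (place α x)
        copyOf (inj₁ _) = tt
        copyOf (inj₂ j) = copyFor (α j) (copy j)

        allowedAt : ∀ x → Allowed c₀ (place α x)
        allowedAt (inj₁ _) = tt
        allowedAt (inj₂ j) = allowed j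

        κ : Var → Pos w
        κ x = realize (place α x) (copyOf x)

        ordered : ∀ x y → key c₀ (place α x) <ᴷ key c₀ (place α y) → CopiesOrdered (place α x) (place α y) (copyOf x) (copyOf y)
        ordered (inj₁ _) _         _ = tt
        ordered (inj₂ j) (inj₁ _)  _ = ordered-before-mark (α j)
        ordered (inj₂ j) (inj₂ j′) h = ordered-for (α j) (α j′) (copy-< {j} {j′} h)

        equal : ∀ x y → key c₀ (place α x) ≡ key c₀ (place α y) → CopiesEqual (place α x) (place α y) (copyOf x) (copyOf y)
        equal (inj₁ _) _         _ = tt
        equal (inj₂ j) (inj₁ _)  _ = equal-at-mark (α j)
        equal (inj₂ j) (inj₂ j′) e = equal-for (α j) (α j′) (copy-≡ {j} {j′} e)

        same : ∀ x → toℕ ([ ξ , κ ∘ inj₂ ] x) ≡ toℕ (κ x)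
        same (inj₁ i) = cong toℕ (sym (X-existential i))
        same (inj₂ j) = refl

        labels : ∀ x a → lookup w ([ ξ , κ ∘ inj₂ ] x) a ≡ lookup w (κ x) a
        labels (inj₁ i) a = cong (λ p → lookup w p a) (sym (X-existential i))
        labels (inj₂ j) a = refl

    good₀ : Good c₀
    good₀ = consistent₀ , satisfies

    w⊨ψ⁺ : w ⊨ ∃∀ R K ψ⁺
    w⊨ψ⁺ = X , λ Y → Equivalence.from (evalQF⇔positions w _ ψ⁺) (Equivalence.from (ψ⁺-⇔ w X Y)
      (index certificates c₀ , subst (λ c → Good c × Shape.Describes c (lookup w) X (Y (index certificates c₀)))
                                      (sym (enum-index certificates c₀)) (good₀ , describes₀ _)))

  definable⁺ : Σ₂⁺-definable L
  definable⁺ = ∃∀ R K ψ⁺ , ψ⁺-negFree , λ w → mk⇔ (Completeness.w⊨ψ⁺ w)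
    (λ (X , sat) → Soundness.inL w X (λ Y → Equivalence.to (evalQF⇔positions w _ ψ⁺) (sat Y)))

lemma39 : (k : ℕ) (L : Language k) → Σ₂⁺-definable L ⇔ (Monotone L × Σ₂-definable L)
lemma39 k L = mk⇔
  (λ (φ , φ⁺ , defines) → (λ u v Lu u≤v → Equivalence.from (defines v)
       (Σ₂⁺⇒monotone φ φ⁺ u v (Equivalence.to (defines u) Lu) u≤v)) , φ , defines)
  (λ { (mon , ∃∀ zero m ψ , defines)    → WithoutExistentials.definable⁺ ψ mon defines
     ; (mon , ∃∀ (suc n) m ψ , defines) → WithExistentials.definable⁺ ψ mon defines })
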